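{- Let $w\in\widetilde{C}_n/C_n$ with window $w_i=c_iN+\sigma_i$ ($N=2n+2$, $c_i\in\mathbb{Z}$, $\sigma\in C_n$), and let $\lambda\in L_n$ correspond to $w$ under $w\mapsto(2c_1-e_1,\dots,2nc_n-e_n)$, $(e_1,\dots,e_n)=\Psi(\sigma)$. Let $o(\lceil\lambda\rceil)$ be the number of indices $i\in\{1,\dots,n\}$ for which $\lceil\lambda_i/i\rceil$ is odd. Then \[ o(\lceil\lambda\rceil)=\mathsf{neg}(\sigma)=\beta(w)-\alpha(w). \]
   Context: The affine hyperoctahedral group $\widetilde{C}_n$ is the group (under composition) of bijections $w:\mathbb{Z}\to\mathbb{Z}$ with $w(i+N)=w(i)+N$ and $w(-i)=-w(i)$; it is a Coxeter group with generators $s_0,\dots,s_n$, where $s_i$ ($1\le i\le n-1$) exchanges $i$ and $i+1$, $s_0$ exchanges $-1$ and $1$, and $s_n$ exchanges $n$ and $n+2$ (each extended by the two symmetry conditions). Write $w_i=w(i)$. $C_n$ is the parabolic subgroup generated by $s_0,\dots,s_{n-1}$ (identified with signed permutations of $\{1,\dots,n\}$), and $\widetilde{C}_n/C_n$ is the set of minimal length coset representatives, exactly the $w$ with $0<w_1<\cdots<w_n$; each has a unique representation $w_i=c_iN+\sigma_i$ with $\sigma$ a signed permutation. $\alpha(w)$, $\beta(w)$ are the numbers of occurrences of $s_0$, $s_n$ in any reduced word for $w$. $\mathsf{neg}(\sigma)=\#\{i:\sigma_i<0\}$. $\Psi(\sigma)=(e_1,\dots,e_n)$ where, with $e^*_i=\#\{j<i:|\sigma_j|>|\sigma_i|\}$,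 $e_i=e^*_i$ if $\sigma_i>0$ and $e_i=2i-1-e^*_i$ if $\sigma_i<0$. $L_n$ is the set of integer tuples with $0\le\lambda_1/1\le\cdots\le\lambda_n/n$. -}

module Defs where

open import Data.Nat as ℕ using (ℕ; zero; suc; _≡ᵇ_)
open import Data.Nat.DivMod using (_%_)
open import Data.Integer as ℤ using (ℤ; +_; _+_; _-_; _*_; -_; ∣_∣; _/ℕ_; _%ℕ_; _<_; _≤_)
open import Data.Integer.Properties using (_<?_)
open import Data.Fin using (Fin; toℕ)
open import Data.Bool using (Bool; true; false; if_then_else_; _∧_)
open import Data.List using (List; []; _∷_; length)
open import Data.Product using (_×_)
open import Relation.Nullary using (¬_; does)
open import Relation.Binary.PropositionalEquality using (_≡_; _≢_)
open import Function using (_∘_; id)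

NN : ℕ → ℕ
NN n = suc (suc (2 ℕ.* n))

res : ℕ → ℤ → ℕ
res n j = j %ℕ (NN n)

-- the generators s_0, …, s_n of the affine hyperoctahedral group, as
-- bijections ℤ → ℤ (extended by w(i+N)=w(i)+N and w(-i)=-w(i))
-- s_0 exchanges -1 and 1;  s_i (1≤i≤n-1) exchanges i and i+1;  s_n exchanges n and n+2.
gen : (n : ℕ) → Fin (suc n) → ℤ → ℤ
gen n k j with toℕ k
... | zero =
  if res n j ≡ᵇ 1 then j - + 2
  else if res n j ≡ᵇ (NN n ℕ.∸ 1) then j + + 2
  else j
... | suc i' =
  if toℕ k ≡ᵇ n then
    (if res n j ≡ᵇ n then j + + 2
     else if res n j ≡ᵇ (n ℕ.+ 2) then j - + 2
     else j)
  else
    (if res n j ≡ᵇ toℕ k then j + + 1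
     else if res n j ≡ᵇ (toℕ k ℕ.+ 1) then j - + 1
     else if res n j ≡ᵇ (NN n ℕ.∸ toℕ k) then j - + 1
     else if res n j ≡ᵇ (NN n ℕ.∸ toℕ k ℕ.∸ 1) then j + + 1
     else j)

evalWord : (n : ℕ) → List (Fin (suc n)) → ℤ → ℤ
evalWord n [] = id
evalWord n (a ∷ as) = gen n a ∘ evalWord n as

pos : {n : ℕ} → Fin n → ℤ
pos i = + (suc (toℕ i))

-- the word u represents the element with window W (W i = w_{i+1});
-- an element of C̃_n is determined by its window
Represents : (n : ℕ) → (Fin n → ℤ) → List (Fin (suc n)) → Set
Represents n W u = ∀ i → evalWord n u (pos i) ≡ W i

IsReducedWord : (n : ℕ) → (Fin n → ℤ) → List (Fin (suc n)) → Set
IsReducedWord n W u =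
  Represents n W u × (∀ v → Represents n W v → length u ℕ.≤ length v)

occ : {n : ℕ} → Fin (suc n) → List (Fin (suc n)) → ℕ
occ a [] = 0
occ a (b ∷ bs) = (if toℕ a ≡ᵇ toℕ b then 1 else 0) ℕ.+ occ a bs

IsSignedPerm : (n : ℕ) → (Fin n → ℤ) → Set
IsSignedPerm n σ =
  (∀ i → σ i ≢ + 0) × (∀ i → ∣ σ i ∣ ℕ.≤ n) × (∀ i j → ∣ σ i ∣ ≡ ∣ σ j ∣ → i ≡ j)

countFin : (n : ℕ) → (Fin n → Bool) → ℕ
countFin zero p = 0
countFin (suc n) p = (if p Fin.zero then 1 else 0) ℕ.+ countFin n (p ∘ Fin.suc)
  where import Data.Fin as Fin

neg : (n : ℕ) → (Fin n → ℤ) → ℕ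
neg n σ = countFin n (λ i → does (σ i <? + 0))

eStar : (n : ℕ) → (Fin n → ℤ) → Fin n → ℕ
eStar n σ i = countFin n (λ j → does (toℕ j ℕ.<? toℕ i) ∧ does (∣ σ i ∣ ℕ.<? ∣ σ j ∣))

Psi : (n : ℕ) → (Fin n → ℤ) → Fin n → ℤ
Psi n σ i =
  if does (σ i <? + 0)
  then + (2 ℕ.* suc (toℕ i) ℕ.∸ 1) - + (eStar n σ i)
  else + (eStar n σ i)

lam : (n : ℕ) → (Fin n → ℤ) → (Fin n → ℤ) → Fin n → ℤ
lam n c σ i = + (2 ℕ.* suc (toℕ i)) * c i - Psi n σ i

ceilDiv : ℤ → (d : ℕ) → .{{ℕ.NonZero d}} → ℤ
ceilDiv a d = - ((- a) /ℕ d)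

isOdd : ℤ → Bool
isOdd x = (∣ x ∣ % 2) ≡ᵇ 1

oddCeil : (n : ℕ) → (Fin n → ℤ) → ℕ
oddCeil n l = countFin n (λ i → isOdd (ceilDiv (l i) (suc (toℕ i))))

-- The length of an element of C̃ₙ counts the walls separating its window w from the identity
-- window: multiples of N met by some wᵢ, by some wᵢ + (n + 1), or by some wᵢ ± wⱼ (i < j). Appending
-- s₀ to a word changes only the first count, sₙ only the second and an interior sᵢ only the third,
-- each by at most one, while a generator lowering the total always exists away from the identity.
-- Hence every reduced word contains exactly as many s₀ (resp. sₙ) as there are walls of the first
-- (resp. second) family. For wᵢ = cᵢN + σᵢ > 0 these are |cᵢ| − [σᵢ < 0] and |cᵢ|, which gives
-- β − α = neg σ; the identity o(⌈λ⌉) = neg σ is a direct computation of ⌈λᵢ/i⌉.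

module Submission where

open import Data.Bool using (Bool; true; false; if_then_else_; T; _∧_)
open import Data.Empty using (⊥; ⊥-elim)
open import Data.Fin as Fin using (Fin; zero; suc; toℕ; inject₁; fromℕ)
import Data.Fin.Properties as Finₚ
import Data.Fin.Relation.Unary.Top as Top
open import Data.Integer as ℤ using (ℤ; +_; -[1+_]; -_; _-_; ∣_∣; _/ℕ_; _%ℕ_)
open import Data.Integer.Properties as ℤₚ using (_<?_)
open import Data.Integer.DivMod using (a≡a%ℕn+[a/ℕn]*n; n%ℕd<d; 0≤n⇒0≤n/ℕd; [n/ℕd]*d≤n; n<s[n/ℕd]*d)
open import Data.Vec.Functional using (updateAt)
open import Data.Vec.Functional.Properties using (updateAt-updates; updateAt-minimal)
open import Data.List using (List; []; _∷_; _++_; [_]; length)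
import Data.List.Properties as Listₚ
open import Data.List.Reverse using (Reverse; []; _∶_∶ʳ_; reverseView)
open import Data.Nat as ℕ using (ℕ; zero; suc; z≤n; s≤s; _≡ᵇ_; _∸_; NonZero)
import Data.Nat.Properties as ℕₚ
open import Data.Product using (Σ; ∃; _×_; _,_; proj₁; proj₂)
open import Data.Sum using (_⊎_; inj₁; inj₂)
open import Function using (_∘_)
open import Relation.Binary.PropositionalEquality hiding ([_])
open import Relation.Nullary using (¬_; yes; no; does)

open import Defs

module IntegerFacts where
  open import Data.Integer using (_+_; _*_; _≤_; _<_)
  open import Data.Integer.Solver using (module +-*-Solver)
  open +-*-Solver

  i+k≡j+k⇒i≡j : ∀ i j k → i + k ≡ j + k → i ≡ j
  i+k≡j+k⇒i≡j i j k eq = begin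
    i           ≡⟨ solve 2 (λ i k → i := (i :+ k) :- k) refl i k ⟩
    (i + k) - k ≡⟨ cong (_- k) eq ⟩
    (j + k) - k ≡⟨ solve 2 (λ j k → (j :+ k) :- k := j) refl j k ⟩
    j           ∎
    where open ≡-Reasoning

  +[m∸n]≡+m-+n : ∀ {m n} → n ℕ.≤ m → + (m ∸ n) ≡ + m - + n
  +[m∸n]≡+m-+n {m} {n} n≤m = trans (sym (ℤₚ.⊖-≥ n≤m)) (sym (ℤₚ.m-n≡m⊖n m n))

  i<1+j⇒i≤j : ∀ {i j} → i < ℤ.suc j → i ≤ j
  i<1+j⇒i≤j {i} {j} i<1+j = subst₂ _≤_ (ℤₚ.pred-suc i) (ℤₚ.pred-suc j) (ℤₚ.pred-mono (ℤₚ.i<j⇒suc[i]≤j i<1+j))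

  ∣i∣≤1+∣i+1∣ : ∀ i → ∣ i ∣ ℕ.≤ suc ∣ i + + 1 ∣
  ∣i∣≤1+∣i+1∣ (+ k)          = ℕₚ.≤-trans (ℕₚ.n≤1+n k) (ℕₚ.≤-trans (ℕₚ.≤-reflexive (ℕₚ.+-comm 1 k)) (ℕₚ.n≤1+n _))
  ∣i∣≤1+∣i+1∣ -[1+ zero ]    = ℕₚ.≤-refl
  ∣i∣≤1+∣i+1∣ -[1+ suc k ]   = ℕₚ.≤-refl

  0≤i⇒∣i+1∣≡1+∣i∣ : ∀ {i} → + 0 ≤ i → ∣ i + + 1 ∣ ≡ suc ∣ i ∣
  0≤i⇒∣i+1∣≡1+∣i∣ {+ k} _ = ℕₚ.+-comm k 1

  1≤i⇒1+∣i-1∣≡∣i∣ : ∀ {i} → + 1 ≤ i → suc ∣ i - + 1 ∣ ≡ ∣ i ∣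
  1≤i⇒1+∣i-1∣≡∣i∣ {+ suc k} _          = refl
  1≤i⇒1+∣i-1∣≡∣i∣ {+ zero}  (ℤ.+≤+ ())

  i<0⇒1+∣-i-1∣≡∣i∣ : ∀ {i} → i < + 0 → suc ∣ - i - + 1 ∣ ≡ ∣ i ∣
  i<0⇒1+∣-i-1∣≡∣i∣ { -[1+ k ]} _          = refl
  i<0⇒1+∣-i-1∣≡∣i∣ {+ k}       (ℤ.+<+ ())

  increasing-tight : ∀ k (W : Fin (suc k) → ℤ) a → a ≤ W zero → (∀ (i : Fin k) → W (inject₁ i) < W (suc i)) →
                     W (fromℕ k) ≤ a + + k → ∀ r → W r ≡ a + + toℕ r
  increasing-tight zero    W a a≤W₀ _ W₀≤a zero = ℤₚ.≤-antisym W₀≤a (subst (_≤ W zero) (sym (ℤₚ.+-identityʳ a)) a≤W₀)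
  increasing-tight (suc k) W a a≤W₀ incr W-last≤ = tight
    where
    a+1≤W₁ : a + + 1 ≤ W (suc zero)
    a+1≤W₁ = subst (_≤ W (suc zero)) (ℤₚ.+-comm (+ 1) a) (ℤₚ.i<j⇒suc[i]≤j (ℤₚ.≤-<-trans a≤W₀ (incr zero)))
    tail-tight = increasing-tight k (W ∘ suc) (a + + 1) a+1≤W₁ (incr ∘ suc)
      (subst (W (suc (fromℕ k)) ℤ.≤_) (sym (ℤₚ.+-assoc a (+ 1) (+ k))) W-last≤)
    tight : ∀ r → W r ≡ a + + toℕ r
    tight (suc r) = trans (tail-tight r) (ℤₚ.+-assoc a (+ 1) (+ toℕ r))
    tight zero    = ℤₚ.≤-antisym (subst (W zero ℤ.≤_) (sym (ℤₚ.+-identityʳ a)) (i<1+j⇒i≤j W₀<1+a))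
                                 (subst (_≤ W zero) (sym (ℤₚ.+-identityʳ a)) a≤W₀)
      where
      W₀<1+a : W zero < ℤ.suc a
      W₀<1+a = subst (W zero ℤ.<_) (trans (tail-tight zero) (trans (ℤₚ.+-identityʳ (a + + 1)) (ℤₚ.+-comm a (+ 1)))) (incr zero)

  i<0⇒i≡-∣i∣ : ∀ {i} → i < + 0 → i ≡ - + ∣ i ∣
  i<0⇒i≡-∣i∣ { -[1+ _ ]} _          = refl
  i<0⇒i≡-∣i∣ {+ _}       (ℤ.+<+ ())

open IntegerFacts

module FloorDivision (N : ℕ) ⦃ _ : NonZero N ⦄ where
  open import Data.Integer using (_+_; _*_; _≤_; _<_)
  open import Data.Integer.Solver using (module +-*-Solver)
  open +-*-Solver

  private
    quotient-≤ : ∀ x a b ρ₁ ρ₂ → ρ₁ ℕ.< N → x ≡ + ρ₁ + a * + N → x ≡ + ρ₂ + b * + N → b ≤ a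
    quotient-≤ x a b ρ₁ ρ₂ ρ₁<N x≡₁ x≡₂ = i<1+j⇒i≤j (ℤₚ.*-cancelʳ-<-nonNeg (+ N) (begin-strict
      b * + N           ≤⟨ ℤₚ.i≤j⇒i≤k+j (+ ρ₂) ℤₚ.≤-refl ⟩
      + ρ₂ + b * + N    ≡⟨ trans (sym x≡₂) x≡₁ ⟩
      + ρ₁ + a * + N    <⟨ ℤₚ.+-monoˡ-< (a * + N) (ℤ.+<+ ρ₁<N) ⟩
      + N + a * + N     ≡⟨ sym (ℤₚ.suc-* a (+ N)) ⟩
      ℤ.suc a * + N     ∎))
      where open ℤₚ.≤-Reasoning

  divMod-unique : ∀ x q ρ → ρ ℕ.< N → x ≡ + ρ + q * + N → (x /ℕ N ≡ q) × (x %ℕ N ≡ ρ)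
  divMod-unique x q ρ ρ<N x≡ = q≡ , ℤₚ.+-injective (i+k≡j+k⇒i≡j _ _ (q * + N) ρ≡)
    where
    x≡′ = a≡a%ℕn+[a/ℕn]*n x N
    q≡ : x /ℕ N ≡ q
    q≡ = ℤₚ.≤-antisym (quotient-≤ x q _ ρ _ ρ<N x≡ x≡′) (quotient-≤ x _ q _ ρ (n%ℕd<d x N) x≡′ x≡)
    ρ≡ : + (x %ℕ N) + q * + N ≡ + ρ + q * + N
    ρ≡ = trans (subst (λ z → + (x %ℕ N) + z * + N ≡ x) q≡ (sym x≡′)) x≡

  divMod-+-multiple : ∀ x k → ((x + k * + N) /ℕ N ≡ x /ℕ N + k) × ((x + k * + N) %ℕ N ≡ x %ℕ N)
  divMod-+-multiple x k = divMod-unique _ _ _ (n%ℕd<d x N) (trans (cong (_+ k * + N) (a≡a%ℕn+[a/ℕn]*n x N))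
    (solve 4 (λ r q k n → (r :+ q :* n) :+ k :* n := r :+ (q :+ k) :* n) refl (+ (x %ℕ N)) (x /ℕ N) k (+ N)))

  divMod-small : ∀ s → s ℕ.< N → (+ s /ℕ N ≡ + 0) × (+ s %ℕ N ≡ s)
  divMod-small s s<N = divMod-unique (+ s) (+ 0) s s<N (sym (ℤₚ.+-identityʳ (+ s)))

  NotMultiple : ℤ → Set
  NotMultiple x = x %ℕ N ≢ 0

  divMod-neg : ∀ x → NotMultiple x → ((- x) /ℕ N ≡ - (x /ℕ N) - + 1) × ((- x) %ℕ N ≡ N ∸ x %ℕ N)
  divMod-neg x x≢0 = divMod-unique (- x) _ _ N-ρ<N (trans (cong -_ (a≡a%ℕn+[a/ℕn]*n x N)) (trans
    (solve 3 (λ r q n → :- (r :+ q :* n) := (n :- r) :+ (:- q :- con (+ 1)) :* n) refl (+ ρ) (x /ℕ N) (+ N))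
    (cong (_+ (- (x /ℕ N) - + 1) * + N) (sym (+[m∸n]≡+m-+n (ℕₚ.<⇒≤ ρ<N))))))
    where
    ρ = x %ℕ N
    ρ<N = n%ℕd<d x N
    N-ρ<N : N ∸ ρ ℕ.< N
    N-ρ<N = ℕₚ.∸-monoʳ-< {o = 0} (ℕₚ.n≢0⇒n>0 x≢0) (ℕₚ.<⇒≤ ρ<N)

  mod-neg-multiple : ∀ x → x %ℕ N ≡ 0 → (- x) %ℕ N ≡ 0
  mod-neg-multiple x ρ≡0 = proj₂ (divMod-unique (- x) (- (x /ℕ N)) 0 (ℕ.>-nonZero⁻¹ N)
    (trans (cong -_ (trans (a≡a%ℕn+[a/ℕn]*n x N) (cong (λ r → + r + x /ℕ N * + N) ρ≡0)))
      (solve 2 (λ q n → :- (con (+ 0) :+ q :* n) := con (+ 0) :+ (:- q) :* n) refl (x /ℕ N) (+ N))))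

  notMultiple-neg : ∀ x → NotMultiple x → NotMultiple (- x)
  notMultiple-neg x x≢0 eq = ℕₚ.m>n⇒m∸n≢0 (n%ℕd<d x N) (trans (sym (proj₂ (divMod-neg x x≢0))) eq)

  notMultiple-+-multiple : ∀ x k → NotMultiple x → NotMultiple (x + k * + N)
  notMultiple-+-multiple x k x≢0 eq = x≢0 (trans (sym (proj₂ (divMod-+-multiple x k))) eq)

  notMultiple-small : ∀ s → s ≢ + 0 → ∣ s ∣ ℕ.< N → NotMultiple s
  notMultiple-small (+ zero)    s≢0 _   = λ _ → s≢0 refl
  notMultiple-small (+ suc t)   _   s<N = λ eq → ℕₚ.0≢1+n (trans (sym eq) (proj₂ (divMod-small (suc t) s<N)))
  notMultiple-small -[1+ t ]    _   s<N = notMultiple-neg (+ suc t) (notMultiple-small (+ suc t) (λ ()) s<N)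

  notMultiple-reflect : ∀ x k → NotMultiple x → NotMultiple (- x + k * + N)
  notMultiple-reflect x k = notMultiple-+-multiple (- x) k ∘ notMultiple-neg x

  notMultiple-N : ¬ NotMultiple (+ N)
  notMultiple-N x≢0 = x≢0 (proj₂ (divMod-unique (+ N) (+ 1) 0 (ℕ.>-nonZero⁻¹ N)
    (sym (trans (ℤₚ.+-identityˡ (+ 1 * + N)) (ℤₚ.*-identityˡ (+ N))))))

  /ℕ-neg : ∀ x → x < + 0 → x /ℕ N < + 0
  /ℕ-neg x x<0 = ℤₚ.*-cancelʳ-<-nonNeg (+ N) (ℤₚ.≤-<-trans ([n/ℕd]*d≤n x N) x<0)

  /ℕ-≥1 : ∀ x → + N ≤ x → + 1 ≤ x /ℕ N
  /ℕ-≥1 x N≤x = i<1+j⇒i≤j (ℤₚ.*-cancelʳ-<-nonNeg {+ 1} (+ N)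
    (subst (ℤ._< ℤ.suc (x /ℕ N) * + N) (sym (ℤₚ.*-identityˡ (+ N))) (ℤₚ.≤-<-trans N≤x (n<s[n/ℕd]*d x N))))

  -- For x not a multiple of N, the number of multiples of N strictly between x and the interval (0, N).
  walls : ℤ → ℕ
  walls x = ∣ x /ℕ N ∣

  walls-+-multiple : ∀ x k → walls (x + k * + N) ≡ ∣ x /ℕ N + k ∣
  walls-+-multiple x k = cong ∣_∣ (proj₁ (divMod-+-multiple x k))

  walls-neg : ∀ x → NotMultiple x → walls (- x) ≡ ∣ - (x /ℕ N) - + 1 ∣
  walls-neg x x≢0 = cong ∣_∣ (proj₁ (divMod-neg x x≢0))

  walls-reflect : ∀ x → NotMultiple x → walls (- x + + 1 * + N) ≡ walls x
  walls-reflect x x≢0 = begin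
    walls (- x + + 1 * + N)        ≡⟨ walls-+-multiple (- x) (+ 1) ⟩
    ∣ - x /ℕ N + + 1 ∣             ≡⟨ cong (λ z → ∣ z + + 1 ∣) (proj₁ (divMod-neg x x≢0)) ⟩
    ∣ - (x /ℕ N) - + 1 + + 1 ∣     ≡⟨ cong ∣_∣ (solve 1 (λ q → (:- q :- con (+ 1)) :+ con (+ 1) := :- q) refl (x /ℕ N)) ⟩
    ∣ - (x /ℕ N) ∣                 ≡⟨ ℤₚ.∣-i∣≡∣i∣ (x /ℕ N) ⟩
    walls x                        ∎
    where open ≡-Reasoning

  walls-+N : ∀ x → walls (x + + N) ≡ ∣ x /ℕ N + + 1 ∣
  walls-+N x = trans (cong (λ z → walls (x + z)) (sym (ℤₚ.*-identityˡ (+ N)))) (walls-+-multiple x (+ 1))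

  walls-neg-≤ : ∀ x → NotMultiple x → walls (- x) ℕ.≤ suc (walls x)
  walls-neg-≤ x x≢0 = subst₂ ℕ._≤_ (sym (walls-neg x x≢0)) (cong suc ∣-q-1+1∣≡∣q∣) (∣i∣≤1+∣i+1∣ (- q - + 1))
    where
    q = x /ℕ N
    ∣-q-1+1∣≡∣q∣ : ∣ - q - + 1 + + 1 ∣ ≡ ∣ q ∣
    ∣-q-1+1∣≡∣q∣ = trans (cong ∣_∣ (solve 1 (λ q → (:- q :- con (+ 1)) :+ con (+ 1) := :- q) refl q)) (ℤₚ.∣-i∣≡∣i∣ q)

  walls-neg-<0 : ∀ x → NotMultiple x → x < + 0 → suc (walls (- x)) ≡ walls x
  walls-neg-<0 x x≢0 x<0 = trans (cong suc (walls-neg x x≢0)) (i<0⇒1+∣-i-1∣≡∣i∣ (/ℕ-neg x x<0))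

  walls-complement : ∀ x → NotMultiple x → walls (+ N - x) ≡ walls x
  walls-complement x x≢0 = trans (cong walls (solve 2 (λ x N → N :- x := :- x :+ con (+ 1) :* N) refl x (+ N))) (walls-reflect x x≢0)

  pairWalls : ℤ → ℤ → ℕ
  pairWalls x y = walls (x - y + + N) ℕ.+ walls (x + y)

  pairWalls-neg : ∀ x y → NotMultiple (x + y) → NotMultiple (x - y) → pairWalls (- x) y ≡ pairWalls x y
  pairWalls-neg x y x+y≢0 x-y≢0 = trans (cong₂ ℕ._+_ first second) (ℕₚ.+-comm (walls (x + y)) _)
    where
    q = (x - y) /ℕ N
    first : walls (- x - y + + N) ≡ walls (x + y)
    first = trans (cong walls (solve 3 (λ x y N → :- x :- y :+ N := :- (x :+ y) :+ con (+ 1) :* N) refl x y (+ N)))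
                  (walls-reflect (x + y) x+y≢0)
    second : walls (- x + y) ≡ walls (x - y + + N)
    second = begin
      walls (- x + y)    ≡⟨ cong walls (solve 2 (λ x y → :- x :+ y := :- (x :- y)) refl x y) ⟩
      walls (- (x - y))  ≡⟨ walls-neg (x - y) x-y≢0 ⟩
      ∣ - q - + 1 ∣      ≡⟨ cong ∣_∣ (solve 1 (λ q → :- q :- con (+ 1) := :- (q :+ con (+ 1))) refl q) ⟩
      ∣ - (q + + 1) ∣    ≡⟨ ℤₚ.∣-i∣≡∣i∣ (q + + 1) ⟩
      ∣ q + + 1 ∣        ≡⟨ walls-+N (x - y) ⟨
      walls (x - y + + N) ∎
      where open ≡-Reasoning

  pairWalls-complement : ∀ x y → pairWalls x (+ N - y) ≡ pairWalls x y
  pairWalls-complement x y = trans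
    (cong₂ ℕ._+_ (cong walls (solve 3 (λ x y N → x :- (N :- y) :+ N := x :+ y) refl x y (+ N)))
                 (cong walls (solve 3 (λ x y N → x :+ (N :- y) := x :- y :+ N) refl x y (+ N))))
    (ℕₚ.+-comm (walls (x + y)) _)

  private
    pairWalls-swap≡ : ∀ x y → NotMultiple (x - y) → pairWalls y x ≡ ∣ (x - y) /ℕ N ∣ ℕ.+ walls (x + y)
    pairWalls-swap≡ x y x-y≢0 = cong₂ ℕ._+_
      (trans (cong walls (solve 3 (λ x y N → y :- x :+ N := :- (x :- y) :+ con (+ 1) :* N) refl x y (+ N)))
             (walls-reflect (x - y) x-y≢0))
      (cong walls (ℤₚ.+-comm y x))

    pairWalls≡ : ∀ x y → pairWalls x y ≡ ∣ (x - y) /ℕ N + + 1 ∣ ℕ.+ walls (x + y)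
    pairWalls≡ x y = cong (ℕ._+ walls (x + y)) (walls-+N (x - y))

  pairWalls-swap-≤ : ∀ x y → NotMultiple (x - y) → pairWalls y x ℕ.≤ suc (pairWalls x y)
  pairWalls-swap-≤ x y x-y≢0 = subst₂ ℕ._≤_ (sym (pairWalls-swap≡ x y x-y≢0)) (cong suc (sym (pairWalls≡ x y)))
    (ℕₚ.+-monoˡ-≤ (walls (x + y)) (∣i∣≤1+∣i+1∣ ((x - y) /ℕ N)))

  pairWalls-swap-< : ∀ x y → NotMultiple (x - y) → y < x → suc (pairWalls y x) ≡ pairWalls x y
  pairWalls-swap-< x y x-y≢0 y<x = begin
    suc (pairWalls y x)                                ≡⟨ cong suc (pairWalls-swap≡ x y x-y≢0) ⟩
    suc (∣ (x - y) /ℕ N ∣ ℕ.+ walls (x + y))           ≡⟨ cong (ℕ._+ walls (x + y)) (0≤i⇒∣i+1∣≡1+∣i∣ 0≤q) ⟨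
    ∣ (x - y) /ℕ N + + 1 ∣ ℕ.+ walls (x + y)           ≡⟨ pairWalls≡ x y ⟨
    pairWalls x y                                      ∎
    where
    open ≡-Reasoning
    0≤q = 0≤n⇒0≤n/ℕd (x - y) N (ℤₚ.i≤j⇒0≤j-i (ℤₚ.<⇒≤ y<x))

module CeilingParity where
  open import Data.Integer using (_+_; _*_; _≤_; _<_)
  open import Data.Integer.Solver using (module +-*-Solver)
  open +-*-Solver
  open import Data.Nat.DivMod using (_%_; [m+kn]%n≡m%n; m*n%n≡0)

  ceilDiv-*-∸ : ∀ q ρ d ⦃ _ : NonZero d ⦄ → ρ ℕ.< d → ceilDiv (q * + d - + ρ) d ≡ q
  ceilDiv-*-∸ q ρ d ρ<d = trans (cong -_ (proj₁ (divMod-unique (- (q * + d - + ρ)) (- q) ρ ρ<d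
    (solve 3 (λ q d ρ → :- (q :* d :- ρ) := ρ :+ (:- q) :* d) refl q (+ d) (+ ρ))))) (ℤₚ.neg-involutive q)
    where open FloorDivision d

  isOdd-2* : ∀ c → isOdd (+ 2 * c) ≡ false
  isOdd-2* c = cong (_≡ᵇ 1) (trans (cong (_% 2) (trans (ℤₚ.abs-* (+ 2) c) (ℕₚ.*-comm 2 ∣ c ∣))) (m*n%n≡0 ∣ c ∣ 2))

  private
    isOdd-1+2* : ∀ j → isOdd (+ (1 ℕ.+ j ℕ.* 2)) ≡ true
    isOdd-1+2* j = cong (_≡ᵇ 1) ([m+kn]%n≡m%n 1 j 2)

    +[1+2*]≡ : ∀ j → + (1 ℕ.+ j ℕ.* 2) ≡ + 1 + + j * + 2
    +[1+2*]≡ j = trans (ℤₚ.pos-+ 1 (j ℕ.* 2)) (cong (λ z → + 1 + z) (ℤₚ.pos-* j 2))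

  isOdd-2*-1 : ∀ c → isOdd (+ 2 * c - + 1) ≡ true
  isOdd-2*-1 (+ zero)  = refl
  isOdd-2*-1 (+ suc k) = subst (λ z → isOdd z ≡ true) (sym 2c-1≡) (isOdd-1+2* k)
    where
    2c-1≡ : + 2 * + suc k - + 1 ≡ + (1 ℕ.+ k ℕ.* 2)
    2c-1≡ = trans (solve 1 (λ k → con (+ 2) :* (con (+ 1) :+ k) :- con (+ 1) := con (+ 1) :+ k :* con (+ 2)) refl (+ k))
                  (sym (+[1+2*]≡ k))
  isOdd-2*-1 -[1+ k ]  = subst (λ z → isOdd z ≡ true) (sym 2c-1≡) (trans (cong (λ k → k % 2 ≡ᵇ 1) (ℤₚ.∣-i∣≡∣i∣ (+ (1 ℕ.+ suc k ℕ.* 2))))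
                                                                         (isOdd-1+2* (suc k)))
    where
    2c-1≡ : + 2 * -[1+ k ] - + 1 ≡ - + (1 ℕ.+ suc k ℕ.* 2)
    2c-1≡ = trans (solve 1 (λ k → con (+ 2) :* (:- (con (+ 1) :+ k)) :- con (+ 1)
                                   := :- (con (+ 1) :+ (con (+ 1) :+ k) :* con (+ 2))) refl (+ k))
                  (cong -_ (sym (+[1+2*]≡ (suc k))))

  countFin-cong : ∀ k {p q : Fin k → Bool} → (∀ j → p j ≡ q j) → countFin k p ≡ countFin k q
  countFin-cong zero    p≡q = refl
  countFin-cong (suc k) p≡q = cong₂ ℕ._+_ (cong (λ b → if b then 1 else 0) (p≡q zero)) (countFin-cong k (p≡q ∘ suc))

  countFin-below : ∀ k (p : Fin k → Bool) t → (∀ j → p j ≡ true → toℕ j ℕ.< t) → countFin k p ℕ.≤ t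
  countFin-below zero    p t below = z≤n
  countFin-below (suc k) p t below with p zero in p₀
  ... | false = countFin-below k (p ∘ suc) t (λ j pj → ℕₚ.<-trans (ℕₚ.n<1+n (toℕ j)) (below (suc j) pj))
  ... | true with t
  ...   | zero   = ⊥-elim (ℕₚ.n≮0 (below zero p₀))
  ...   | suc t′ = s≤s (countFin-below k (p ∘ suc) t′ (λ j pj → ℕₚ.≤-pred (below (suc j) pj)))

  eStar≤ : ∀ n σ (i : Fin n) → eStar n σ i ℕ.≤ toℕ i
  eStar≤ n σ i = countFin-below n _ (toℕ i) earlier
    where
    earlier : ∀ j → (does (toℕ j ℕ.<? toℕ i) ∧ does (∣ σ i ∣ ℕ.<? ∣ σ j ∣)) ≡ true → toℕ j ℕ.< toℕ i
    earlier j p with toℕ j ℕ.<ᵇ toℕ i in j<ᵇi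
    ... | true = ℕₚ.<ᵇ⇒< (toℕ j) (toℕ i) (subst T (sym j<ᵇi) _)

  -- With d = i + 1: λᵢ = 2cᵢ·d − e*ᵢ if σᵢ > 0 and λᵢ = (2cᵢ − 1)·d − (i − e*ᵢ) if σᵢ < 0, both
  -- subtracted amounts lying in [0, d); so ⌈λᵢ/d⌉ is 2cᵢ or 2cᵢ − 1.
  ceil-isOdd : ∀ n c σ (i : Fin n) → isOdd (ceilDiv (lam n c σ i) (suc (toℕ i))) ≡ does (σ i <? + 0)
  ceil-isOdd n c σ i with σ i <? + 0
  ... | no _  = trans (cong isOdd (trans (cong ceilDiv′ λ≡) (ceilDiv-*-∸ (+ 2 * c i) e d (s≤s (eStar≤ n σ i)))))
                      (isOdd-2* (c i))
    where
    t = toℕ i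
    d = suc t
    e = eStar n σ i
    ceilDiv′ = λ x → ceilDiv x d
    λ≡ : + (2 ℕ.* d) * c i - + e ≡ + 2 * c i * + d - + e
    λ≡ = cong (_- + e) (trans (cong (_* c i) (ℤₚ.pos-* 2 d))
      (solve 2 (λ c d → con (+ 2) :* d :* c := con (+ 2) :* c :* d) refl (c i) (+ d)))
  ... | yes _ = trans (cong isOdd (trans (cong ceilDiv′ λ≡) (ceilDiv-*-∸ (+ 2 * c i - + 1) (t ∸ e) d (s≤s (ℕₚ.m∸n≤m t e)))))
                      (isOdd-2*-1 (c i))
    where
    t = toℕ i
    d = suc t
    e = eStar n σ i
    ceilDiv′ = λ x → ceilDiv x d
    2d∸1≡ : + (2 ℕ.* d ∸ 1) ≡ + t + + d
    2d∸1≡ = cong (λ z → + (t ℕ.+ z)) (ℕₚ.+-identityʳ d)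
    λ≡ : + (2 ℕ.* d) * c i - (+ (2 ℕ.* d ∸ 1) - + e) ≡ (+ 2 * c i - + 1) * + d - + (t ∸ e)
    λ≡ = trans (cong₂ (λ x y → x * c i - (y - + e)) (ℤₚ.pos-* 2 d) 2d∸1≡)
      (trans (solve 4 (λ c d e t → con (+ 2) :* d :* c :- ((t :+ d) :- e) := (con (+ 2) :* c :- con (+ 1)) :* d :- (t :- e))
                      refl (c i) (+ d) (+ e) (+ t))
             (cong (λ z → (+ 2 * c i - + 1) * + d - z) (sym (+[m∸n]≡+m-+n (eStar≤ n σ i)))))

  oddCeil≡neg : ∀ n c σ → oddCeil n (lam n c σ) ≡ neg n σ
  oddCeil≡neg n c σ = countFin-cong n (ceil-isOdd n c σ)

module FiniteSums where
  open import Data.Nat using (_+_)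
  open import Data.Nat.Solver using (module +-*-Solver)
  open +-*-Solver
  open import Algebra.Properties.Monoid.Sum ℕₚ.+-0-monoid public using (sum; sum-cong-≗; sum-replicate-zero)

  swapNext : (k : ℕ) → Fin k → Fin (suc k) → Fin (suc k)
  swapNext (suc k) zero    zero          = suc zero
  swapNext (suc k) zero    (suc zero)    = zero
  swapNext (suc k) zero    (suc (suc r)) = suc (suc r)
  swapNext (suc k) (suc i) zero          = zero
  swapNext (suc k) (suc i) (suc r)       = suc (swapNext k i r)

  swapNext-involutive : ∀ k i r → swapNext k i (swapNext k i r) ≡ r
  swapNext-involutive (suc k) zero    zero          = refl
  swapNext-involutive (suc k) zero    (suc zero)    = refl
  swapNext-involutive (suc k) zero    (suc (suc r)) = refl
  swapNext-involutive (suc k) (suc i) zero          = refl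
  swapNext-involutive (suc k) (suc i) (suc r)       = cong suc (swapNext-involutive k i r)

  swapNext-injective : ∀ k i {r r′} → swapNext k i r ≡ swapNext k i r′ → r ≡ r′
  swapNext-injective k i {r} {r′} eq =
    trans (sym (swapNext-involutive k i r)) (trans (cong (swapNext k i) eq) (swapNext-involutive k i r′))

  inject₁≢suc : ∀ {k} (i : Fin k) → inject₁ i ≢ suc i
  inject₁≢suc zero    ()
  inject₁≢suc (suc i) eq = inject₁≢suc i (Finₚ.suc-injective eq)

  swapNext-left : ∀ k i (r : Fin (suc k)) → toℕ r ≡ toℕ i → swapNext k i r ≡ suc i
  swapNext-left (suc k) zero    zero    _  = refl
  swapNext-left (suc k) (suc i) (suc r) eq = cong suc (swapNext-left k i r (ℕₚ.suc-injective eq))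

  swapNext-right : ∀ k i (r : Fin (suc k)) → toℕ r ≡ suc (toℕ i) → swapNext k i r ≡ inject₁ i
  swapNext-right (suc k) zero    (suc zero) _  = refl
  swapNext-right (suc k) (suc i) (suc r)    eq = cong suc (swapNext-right k i r (ℕₚ.suc-injective eq))

  swapNext-other : ∀ k i (r : Fin (suc k)) → toℕ r ≢ toℕ i → toℕ r ≢ suc (toℕ i) → swapNext k i r ≡ r
  swapNext-other (suc k) zero    zero          ne _  = ⊥-elim (ne refl)
  swapNext-other (suc k) zero    (suc zero)    _  ne = ⊥-elim (ne refl)
  swapNext-other (suc k) zero    (suc (suc r)) _  _  = refl
  swapNext-other (suc k) (suc i) zero          _  _  = refl
  swapNext-other (suc k) (suc i) (suc r)       ne ne′ =
    cong suc (swapNext-other k i r (ne ∘ cong suc) (ne′ ∘ cong suc))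

  sum-swapNext : ∀ k i (f : Fin (suc k) → ℕ) → sum (f ∘ swapNext k i) ≡ sum f
  sum-swapNext (suc k) zero    f = solve 3 (λ a b c → b :+ (a :+ c) := a :+ (b :+ c)) refl
    (f zero) (f (suc zero)) (sum (λ r → f (suc (suc r))))
  sum-swapNext (suc k) (suc i) f = cong (f zero ℕ.+_) (sum-swapNext k i (f ∘ suc))

  sum-updateAt : ∀ {A : Set} {k} (f : A → ℕ) (V : Fin k → A) j g →
                 sum (f ∘ updateAt V j g) + f (V j) ≡ sum (f ∘ V) + f (g (V j))
  sum-updateAt {k = suc k} f V zero g =
    solve 3 (λ a b c → a :+ b :+ c := c :+ b :+ a) refl (f (g (V zero))) (sum (f ∘ V ∘ suc)) (f (V zero))
  sum-updateAt {k = suc k} f V (suc j) g = begin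
    f (V zero) + sum (f ∘ updateAt (V ∘ suc) j g) + f (V (suc j))    ≡⟨ ℕₚ.+-assoc (f (V zero)) _ _ ⟩
    f (V zero) + (sum (f ∘ updateAt (V ∘ suc) j g) + f (V (suc j)))  ≡⟨ cong (f (V zero) ℕ.+_) (sum-updateAt f (V ∘ suc) j g) ⟩
    f (V zero) + (sum (f ∘ V ∘ suc) + f (g (V (suc j))))              ≡⟨ ℕₚ.+-assoc (f (V zero)) _ _ ⟨
    f (V zero) + sum (f ∘ V ∘ suc) + f (g (V (suc j)))                ∎
    where open ≡-Reasoning

  sum-≡0 : ∀ {k} (f : Fin k → ℕ) → (∀ r → f r ≡ 0) → sum f ≡ 0
  sum-≡0 {k} f f≡0 = trans (sum-cong-≗ f≡0) (sum-replicate-zero k)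

  sum-+-countFin : ∀ {k} (f : Fin k → ℕ) (p : Fin k → Bool) →
                   sum (λ r → f r + (if p r then 1 else 0)) ≡ sum f + countFin k p
  sum-+-countFin {zero}  f p = refl
  sum-+-countFin {suc k} f p = trans (cong (f zero + δ ℕ.+_) (sum-+-countFin (f ∘ suc) (p ∘ suc)))
    (solve 4 (λ a b c d → (a :+ b) :+ (c :+ d) := (a :+ c) :+ (b :+ d)) refl (f zero) δ (sum (f ∘ suc)) (countFin k (p ∘ suc)))
    where δ = if p zero then 1 else 0

  module PairSum {A : Set} (h : A → A → ℕ) where

    pairSum : (k : ℕ) → (Fin k → A) → ℕ
    pairSum zero    V = 0
    pairSum (suc k) V = sum (λ r → h (V zero) (V (suc r))) + pairSum k (V ∘ suc)

    pairSum-cong : ∀ k (V V′ : Fin k → A) → (∀ r r′ → toℕ r ℕ.< toℕ r′ → h (V′ r) (V′ r′) ≡ h (V r) (V r′)) →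
                   pairSum k V′ ≡ pairSum k V
    pairSum-cong zero    V V′ eq = refl
    pairSum-cong (suc k) V V′ eq = cong₂ _+_ (sum-cong-≗ (λ r → eq zero (suc r) (s≤s z≤n)))
      (pairSum-cong k (V ∘ suc) (V′ ∘ suc) (λ r r′ r<r′ → eq (suc r) (suc r′) (s≤s r<r′)))

    pairSum-swapNext : ∀ k i (V : Fin (suc k) → A) →
      pairSum (suc k) (V ∘ swapNext k i) + h (V (inject₁ i)) (V (suc i)) ≡ pairSum (suc k) V + h (V (suc i)) (V (inject₁ i))
    pairSum-swapNext (suc k) zero V =
      solve 5 (λ P Q S₀ S₁ R → (Q :+ S₁) :+ (S₀ :+ R) :+ P := (P :+ S₀) :+ (S₁ :+ R) :+ Q) refl
        (h (V zero) (V (suc zero))) (h (V (suc zero)) (V zero))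
        (sum (λ r → h (V zero) (V (suc (suc r))))) (sum (λ r → h (V (suc zero)) (V (suc (suc r)))))
        (pairSum k (λ r → V (suc (suc r))))
    pairSum-swapNext (suc k) (suc i) V = begin
      sum (λ r → h (V zero) (V (suc (swapNext k i r)))) + P′ + X  ≡⟨ cong (λ z → z + P′ + X) (sum-swapNext k i (λ r → h (V zero) (V (suc r)))) ⟩
      S + P′ + X                                                   ≡⟨ ℕₚ.+-assoc S P′ X ⟩
      S + (P′ + X)                                                 ≡⟨ cong (S ℕ.+_) (pairSum-swapNext k i (V ∘ suc)) ⟩
      S + (pairSum (suc k) (V ∘ suc) + Y)                          ≡⟨ ℕₚ.+-assoc S _ Y ⟨
      S + pairSum (suc k) (V ∘ suc) + Y                            ∎
      where
      open ≡-Reasoning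
      P′ = pairSum (suc k) (V ∘ suc ∘ swapNext k i)
      X = h (V (suc (inject₁ i))) (V (suc (suc i)))
      Y = h (V (suc (suc i))) (V (suc (inject₁ i)))
      S = sum (λ r → h (V zero) (V (suc r)))

open FiniteSums

module NatArithmetic where
  open import Data.Nat using (_+_; _≤_)
  open import Data.Nat.Solver using (module +-*-Solver)
  open +-*-Solver

  exchange-≤ : ∀ {S S′ a b} → S′ + a ≡ S + b → b ≤ suc a → S′ ≤ suc S
  exchange-≤ {S} {S′} {a} {b} eq b≤1+a = ℕₚ.+-cancelʳ-≤ a S′ (suc S) (begin
    S′ + a     ≡⟨ eq ⟩
    S + b      ≤⟨ ℕₚ.+-monoʳ-≤ S b≤1+a ⟩
    S + suc a  ≡⟨ ℕₚ.+-suc S a ⟩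
    suc S + a  ∎)
    where open ℕₚ.≤-Reasoning

  exchange-≡ : ∀ {S S′ a b} → S′ + a ≡ S + b → b ≡ a → S′ ≡ S
  exchange-≡ {S} {S′} {a} eq b≡a = ℕₚ.+-cancelʳ-≡ a S′ S (trans eq (cong (S ℕ.+_) b≡a))

  exchange-< : ∀ {S S′ a b} → S′ + a ≡ S + b → suc b ≡ a → suc S′ ≡ S
  exchange-< {S} {S′} {a} {b} eq 1+b≡a =
    ℕₚ.+-cancelʳ-≡ b (suc S′) S (trans (sym (ℕₚ.+-suc S′ b)) (trans (cong (S′ ℕ.+_) 1+b≡a) eq))

  add-bound : ∀ {a a′ o d} → a ≤ o → a′ ≤ a + d → a′ ≤ o + d
  add-bound {d = d} a≤o a′≤a+d = ℕₚ.≤-trans a′≤a+d (ℕₚ.+-monoˡ-≤ d a≤o)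

  add-length-bound : ∀ {c c′ o₀ oₙ d₀ dₙ c₀ len} → c + o₀ + oₙ ≤ c₀ + len → c′ + d₀ + dₙ ≤ suc c →
                     c′ + (o₀ + d₀) + (oₙ + dₙ) ≤ c₀ + (len + 1)
  add-length-bound {c} {c′} {o₀} {oₙ} {d₀} {dₙ} {c₀} {len} old step = begin
    c′ + (o₀ + d₀) + (oₙ + dₙ)  ≡⟨ solve 5 (λ c′ o₀ d₀ oₙ dₙ → c′ :+ (o₀ :+ d₀) :+ (oₙ :+ dₙ)
                                              := (c′ :+ d₀ :+ dₙ) :+ (o₀ :+ oₙ)) refl c′ o₀ d₀ oₙ dₙ ⟩
    (c′ + d₀ + dₙ) + (o₀ + oₙ)  ≤⟨ ℕₚ.+-monoˡ-≤ (o₀ + oₙ) step ⟩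
    suc c + (o₀ + oₙ)              ≡⟨ solve 3 (λ c o₀ oₙ → con 1 :+ c :+ (o₀ :+ oₙ)
                                              := (c :+ o₀ :+ oₙ) :+ con 1) refl c o₀ oₙ ⟩
    c + o₀ + oₙ + 1              ≤⟨ ℕₚ.+-monoˡ-≤ 1 old ⟩
    c₀ + len + 1                   ≡⟨ ℕₚ.+-assoc c₀ len 1 ⟩
    c₀ + (len + 1)                 ∎
    where
    open ℕₚ.≤-Reasoning

  tight-bounds : ∀ {a b c x y c₀ z w} → a ≤ x → b ≤ y → c + x + y ≤ c₀ + z → z ≤ w →
                 w + c₀ ≤ a + b + c → (a ≡ x) × (b ≡ y)
  tight-bounds {a} {b} {c} {x} {y} {c₀} {z} {w} a≤x b≤y c+x+y≤ z≤w w+c₀≤ =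
    ℕₚ.≤-antisym a≤x x≤a , ℕₚ.≤-antisym b≤y y≤b
    where
    open ℕₚ.≤-Reasoning
    x+y≤a+b : x + y ≤ a + b
    x+y≤a+b = ℕₚ.+-cancelʳ-≤ c (x + y) (a + b) (begin
      x + y + c    ≡⟨ ℕₚ.+-comm (x + y) c ⟩
      c + (x + y)  ≡⟨ ℕₚ.+-assoc c x y ⟨
      c + x + y    ≤⟨ c+x+y≤ ⟩
      c₀ + z         ≤⟨ ℕₚ.+-monoʳ-≤ c₀ z≤w ⟩
      c₀ + w         ≡⟨ ℕₚ.+-comm c₀ w ⟩
      w + c₀         ≤⟨ w+c₀≤ ⟩
      a + b + c    ∎)
    x≤a : x ≤ a
    x≤a = ℕₚ.+-cancelʳ-≤ y x a (ℕₚ.≤-trans x+y≤a+b (ℕₚ.+-monoʳ-≤ a b≤y))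
    y≤b : y ≤ b
    y≤b = ℕₚ.+-cancelˡ-≤ x y b (ℕₚ.≤-trans x+y≤a+b (ℕₚ.+-monoˡ-≤ b a≤x))

open NatArithmetic

≡ᵇ-true : ∀ {a b} → a ≡ b → (a ≡ᵇ b) ≡ true
≡ᵇ-true {a} {b} = dec-true (a ℕ.≟ b)
  where open import Relation.Nullary.Decidable using (dec-true)

≡ᵇ-false : ∀ {a b} → a ≢ b → (a ≡ᵇ b) ≡ false
≡ᵇ-false {a} {b} = dec-false (a ℕ.≟ b)
  where open import Relation.Nullary.Decidable using (dec-false)

occ-++ : ∀ {k} (a : Fin (suc k)) u b → occ a (u ++ [ b ]) ≡ occ a u ℕ.+ occ a [ b ]
occ-++ a []      b = refl
occ-++ a (c ∷ u) b = trans (cong (δ ℕ.+_) (occ-++ a u b)) (sym (ℕₚ.+-assoc δ (occ a u) (occ a [ b ])))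
  where δ = if toℕ a ≡ᵇ toℕ c then 1 else 0

module Generators where
  open import Data.Integer using (_+_)

  displacement : ℕ → ℕ → ℕ → ℤ
  displacement n zero ρ =
    if ρ ≡ᵇ 1 then - + 2 else if ρ ≡ᵇ (NN n ∸ 1) then + 2 else + 0
  displacement n (suc t) ρ =
    if suc t ≡ᵇ n
    then (if ρ ≡ᵇ n then + 2 else if ρ ≡ᵇ (n ℕ.+ 2) then - + 2 else + 0)
    else (if ρ ≡ᵇ suc t then + 1 else if ρ ≡ᵇ (suc t ℕ.+ 1) then - + 1
          else if ρ ≡ᵇ (NN n ∸ suc t) then - + 1 else if ρ ≡ᵇ (NN n ∸ suc t ∸ 1) then + 1 else + 0)

  private
    if-+ : ∀ (b : Bool) j x {l r} → l ≡ j + r → (if b then j + x else l) ≡ j + (if b then x else r)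
    if-+ true  j x eq = refl
    if-+ false j x eq = eq

    if-+₂ : ∀ (b : Bool) j {l₁ l₂ r₁ r₂} → l₁ ≡ j + r₁ → l₂ ≡ j + r₂ → (if b then l₁ else l₂) ≡ j + (if b then r₁ else r₂)
    if-+₂ true  j eq₁ eq₂ = eq₁
    if-+₂ false j eq₁ eq₂ = eq₂

    +0 : ∀ j → j ≡ j + + 0
    +0 j = sym (ℤₚ.+-identityʳ j)

  gen≡+displacement : ∀ n k j → gen n k j ≡ j + displacement n (toℕ k) (res n j)
  gen≡+displacement n k j with toℕ k in eq
  ... | zero = if-+ (ρ ≡ᵇ 1) j (- + 2) (if-+ (ρ ≡ᵇ (NN n ∸ 1)) j (+ 2) (+0 j))
    where ρ = res n j
  ... | suc t rewrite eq = if-+₂ (suc t ≡ᵇ n) j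
          (if-+ (ρ ≡ᵇ n) j (+ 2) (if-+ (ρ ≡ᵇ (n ℕ.+ 2)) j (- + 2) (+0 j)))
          (if-+ (ρ ≡ᵇ suc t) j (+ 1) (if-+ (ρ ≡ᵇ (suc t ℕ.+ 1)) j (- + 1)
            (if-+ (ρ ≡ᵇ (NN n ∸ suc t)) j (- + 1) (if-+ (ρ ≡ᵇ (NN n ∸ suc t ∸ 1)) j (+ 1) (+0 j)))))
    where ρ = res n j

  Disjoint : Bool → Bool → Set
  Disjoint b₁ b₂ = T b₁ → T b₂ → ⊥

  if-neg₂ : ∀ (b₁ b₂ : Bool) (x y : ℤ) → Disjoint b₁ b₂ →
    (if b₂ then - y else if b₁ then - x else + 0) ≡ - (if b₁ then x else if b₂ then y else + 0)
  if-neg₂ true  true  x y ex = ⊥-elim (ex _ _)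
  if-neg₂ true  false x y ex = refl
  if-neg₂ false true  x y ex = refl
  if-neg₂ false false x y ex = refl

  if-neg₄ : ∀ (b₁ b₂ b₃ b₄ : Bool) →
    Disjoint b₁ b₂ → Disjoint b₁ b₃ → Disjoint b₁ b₄ → Disjoint b₂ b₃ → Disjoint b₂ b₄ → Disjoint b₃ b₄ →
    (if b₃ then + 1 else if b₄ then - + 1 else if b₁ then - + 1 else if b₂ then + 1 else + 0)
      ≡ - (if b₁ then + 1 else if b₂ then - + 1 else if b₃ then - + 1 else if b₄ then + 1 else + 0)
  if-neg₄ true  true  _     _     e₁₂ e₁₃ e₁₄ e₂₃ e₂₄ e₃₄ = ⊥-elim (e₁₂ _ _)
  if-neg₄ true  false true  _     e₁₂ e₁₃ e₁₄ e₂₃ e₂₄ e₃₄ = ⊥-elim (e₁₃ _ _)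
  if-neg₄ true  false false true  e₁₂ e₁₃ e₁₄ e₂₃ e₂₄ e₃₄ = ⊥-elim (e₁₄ _ _)
  if-neg₄ true  false false false e₁₂ e₁₃ e₁₄ e₂₃ e₂₄ e₃₄ = refl
  if-neg₄ false true  true  _     e₁₂ e₁₃ e₁₄ e₂₃ e₂₄ e₃₄ = ⊥-elim (e₂₃ _ _)
  if-neg₄ false true  false true  e₁₂ e₁₃ e₁₄ e₂₃ e₂₄ e₃₄ = ⊥-elim (e₂₄ _ _)
  if-neg₄ false true  false false e₁₂ e₁₃ e₁₄ e₂₃ e₂₄ e₃₄ = refl
  if-neg₄ false false true  true  e₁₂ e₁₃ e₁₄ e₂₃ e₂₄ e₃₄ = ⊥-elim (e₃₄ _ _)
  if-neg₄ false false true  false e₁₂ e₁₃ e₁₄ e₂₃ e₂₄ e₃₄ = refl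
  if-neg₄ false false false true  e₁₂ e₁₃ e₁₄ e₂₃ e₂₄ e₃₄ = refl
  if-neg₄ false false false false e₁₂ e₁₃ e₁₄ e₂₃ e₂₄ e₃₄ = refl

  ≡ᵇ-disjoint : ∀ ρ {x y} → x ℕ.< y → Disjoint (ρ ≡ᵇ x) (ρ ≡ᵇ y)
  ≡ᵇ-disjoint ρ {x} {y} x<y ρ≡x ρ≡y = ℕₚ.<⇒≢ x<y (trans (sym (ℕₚ.≡ᵇ⇒≡ ρ x ρ≡x)) (ℕₚ.≡ᵇ⇒≡ ρ y ρ≡y))

  ∸-≡ᵇ-∸ : ∀ {N} ρ w → ρ ℕ.≤ N → w ℕ.≤ N → (N ∸ ρ ≡ᵇ N ∸ w) ≡ (ρ ≡ᵇ w)
  ∸-≡ᵇ-∸ {N} ρ w ρ≤N w≤N with ρ ℕ.≟ w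
  ... | yes refl = trans (≡ᵇ-true {N ∸ ρ} refl) (sym (≡ᵇ-true {ρ} refl))
  ... | no ρ≢w   = trans (≡ᵇ-false (ρ≢w ∘ ℕₚ.∸-cancelˡ-≡ ρ≤N w≤N)) (sym (≡ᵇ-false ρ≢w))

  ∸-≡ᵇ : ∀ {N} ρ w → ρ ℕ.≤ N → w ℕ.≤ N → (N ∸ ρ ≡ᵇ w) ≡ (ρ ≡ᵇ N ∸ w)
  ∸-≡ᵇ {N} ρ w ρ≤N w≤N =
    trans (cong (N ∸ ρ ≡ᵇ_) (sym (ℕₚ.m∸[m∸n]≡n w≤N))) (∸-≡ᵇ-∸ ρ (N ∸ w) ρ≤N (ℕₚ.m∸n≤m N w))

module PeriodArithmetic (n : ℕ) where
  open import Data.Nat using (_+_; _≤_; _<_)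
  open import Data.Nat.Solver using (module +-*-Solver)
  open +-*-Solver

  N≡n+[n+2] : NN n ≡ n + (n + 2)
  N≡n+[n+2] = solve 1 (λ n → con 2 :+ con 2 :* n := n :+ (n :+ con 2)) refl n

  N≡[1+n]+[1+n] : NN n ≡ suc n + suc n
  N≡[1+n]+[1+n] = solve 1 (λ n → con 2 :+ con 2 :* n := (con 1 :+ n) :+ (con 1 :+ n)) refl n

  n≤N : n ≤ NN n
  n≤N = subst (n ≤_) (sym N≡n+[n+2]) (ℕₚ.m≤m+n n _)

  n+2≤N : n + 2 ≤ NN n
  n+2≤N = subst (n + 2 ≤_) (sym N≡n+[n+2]) (ℕₚ.m≤n+m _ n)

  n+[1+n]<N : n + suc n < NN n
  n+[1+n]<N = subst (n + suc n <_) (sym N≡[1+n]+[1+n]) (ℕₚ.n<1+n _)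

  n<N : n < NN n
  n<N = ℕₚ.≤-<-trans (ℕₚ.m≤m+n n (suc n)) n+[1+n]<N

  1+n<N : suc n < NN n
  1+n<N = ℕₚ.≤-<-trans (ℕₚ.m≤n+m (suc n) n) n+[1+n]<N

  n+n<N : n + n < NN n
  n+n<N = ℕₚ.≤-<-trans (ℕₚ.+-monoʳ-≤ n (ℕₚ.n≤1+n n)) n+[1+n]<N

  N∸n≡n+2 : NN n ∸ n ≡ n + 2
  N∸n≡n+2 = trans (cong (_∸ n) N≡n+[n+2]) (ℕₚ.m+n∸m≡n n _)

  N∸[n+2]≡n : NN n ∸ (n + 2) ≡ n
  N∸[n+2]≡n = trans (cong (_∸ (n + 2)) (trans N≡n+[n+2] (ℕₚ.+-comm n (n + 2)))) (ℕₚ.m+n∸m≡n (n + 2) n)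

module Affine (m : ℕ) where
  open import Data.Integer using (_+_; _*_; _≤_; _<_)
  open import Data.Integer.Solver using (module +-*-Solver)
  open +-*-Solver
  open Generators

  n : ℕ
  n = suc m

  N : ℕ
  N = NN n

  open PeriodArithmetic n
  open FloorDivision N

  module Interior (t : ℕ) (1+t≤n : suc t ℕ.≤ n) (1+t≢n : suc t ≢ n) where
    private
      a : ℕ
      a = suc t
      a+1≤n : a ℕ.+ 1 ℕ.≤ n
      a+1≤n = subst (ℕ._≤ n) (ℕₚ.+-comm 1 a) (ℕₚ.≤∧≢⇒< 1+t≤n 1+t≢n)
      n+2≤N∸[a+1] : n ℕ.+ 2 ℕ.≤ N ∸ (a ℕ.+ 1)
      n+2≤N∸[a+1] = ℕₚ.m+n≤o⇒m≤o∸n (n ℕ.+ 2) (subst (n ℕ.+ 2 ℕ.+ (a ℕ.+ 1) ℕ.≤_) (sym N≡n+[n+2])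
        (subst (ℕ._≤ n ℕ.+ (n ℕ.+ 2)) (ℕₚ.+-comm (a ℕ.+ 1) (n ℕ.+ 2)) (ℕₚ.+-monoˡ-≤ (n ℕ.+ 2) a+1≤n)))

    n<N∸[a+1] : n ℕ.< N ∸ (a ℕ.+ 1)
    n<N∸[a+1] = ℕₚ.<-≤-trans (ℕₚ.m<m+n n {2} (s≤s z≤n)) n+2≤N∸[a+1]

    private
      a+1≤N : a ℕ.+ 1 ℕ.≤ N
      a+1≤N = ℕₚ.≤-trans a+1≤n n≤N
      a≤N : a ℕ.≤ N
      a≤N = ℕₚ.≤-trans (ℕₚ.m≤m+n a 1) a+1≤N
      a<a+1 : a ℕ.< a ℕ.+ 1
      a<a+1 = subst (a ℕ.<_) (ℕₚ.+-comm 1 a) (ℕₚ.n<1+n a)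
      a+1<N∸[a+1] : a ℕ.+ 1 ℕ.< N ∸ (a ℕ.+ 1)
      a+1<N∸[a+1] = ℕₚ.≤-<-trans a+1≤n n<N∸[a+1]
      N∸[a+1]<N∸a : N ∸ (a ℕ.+ 1) ℕ.< N ∸ a
      N∸[a+1]<N∸a = ℕₚ.∸-monoʳ-< a<a+1 a+1≤N
      a<N∸[a+1] : a ℕ.< N ∸ (a ℕ.+ 1)
      a<N∸[a+1] = ℕₚ.<-trans a<a+1 a+1<N∸[a+1]
      a<N∸a : a ℕ.< N ∸ a
      a<N∸a = ℕₚ.<-trans a<N∸[a+1] N∸[a+1]<N∸a
      a+1<N∸a : a ℕ.+ 1 ℕ.< N ∸ a
      a+1<N∸a = ℕₚ.<-trans a+1<N∸[a+1] N∸[a+1]<N∸a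

    n<N∸a : n ℕ.< N ∸ a
    n<N∸a = ℕₚ.<-trans n<N∸[a+1] N∸[a+1]<N∸a

    displacement-reflect : ∀ ρ → ρ ℕ.< N → displacement n a (N ∸ ρ) ≡ - displacement n a ρ
    displacement-reflect ρ ρ<N
      rewrite ≡ᵇ-false 1+t≢n | ℕₚ.∸-+-assoc N a 1
            | ∸-≡ᵇ-∸ ρ a (ℕₚ.<⇒≤ ρ<N) a≤N | ∸-≡ᵇ-∸ ρ (a ℕ.+ 1) (ℕₚ.<⇒≤ ρ<N) a+1≤N
            | ∸-≡ᵇ ρ a (ℕₚ.<⇒≤ ρ<N) a≤N | ∸-≡ᵇ ρ (a ℕ.+ 1) (ℕₚ.<⇒≤ ρ<N) a+1≤N =
      if-neg₄ (ρ ≡ᵇ a) (ρ ≡ᵇ (a ℕ.+ 1)) (ρ ≡ᵇ (N ∸ a)) (ρ ≡ᵇ (N ∸ (a ℕ.+ 1)))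
        (≡ᵇ-disjoint ρ a<a+1) (≡ᵇ-disjoint ρ a<N∸a) (≡ᵇ-disjoint ρ a<N∸[a+1])
        (≡ᵇ-disjoint ρ a+1<N∸a) (≡ᵇ-disjoint ρ a+1<N∸[a+1]) (λ b₃ b₄ → ≡ᵇ-disjoint ρ N∸[a+1]<N∸a b₄ b₃)

    displacement-0 : displacement n a 0 ≡ + 0
    displacement-0 rewrite ≡ᵇ-false 1+t≢n | ℕₚ.∸-+-assoc N a 1
                         | ≡ᵇ-false {0} {N ∸ a} (ℕₚ.<⇒≢ (ℕₚ.≤-<-trans z≤n a<N∸a))
                         | ≡ᵇ-false {0} {N ∸ (a ℕ.+ 1)} (ℕₚ.<⇒≢ (ℕₚ.≤-<-trans z≤n a+1<N∸[a+1])) = refl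

  displacement-reflect : ∀ t → t ℕ.≤ n → ∀ ρ → ρ ℕ.< N → displacement n t (N ∸ ρ) ≡ - displacement n t ρ
  displacement-reflect zero _ ρ ρ<N
    rewrite ∸-≡ᵇ ρ 1 (ℕₚ.<⇒≤ ρ<N) (s≤s z≤n) | ∸-≡ᵇ-∸ ρ 1 (ℕₚ.<⇒≤ ρ<N) (s≤s z≤n) =
    if-neg₂ (ρ ≡ᵇ 1) (ρ ≡ᵇ (N ∸ 1)) (- + 2) (+ 2) (≡ᵇ-disjoint ρ (s≤s (s≤s z≤n)))
  displacement-reflect (suc t) t≤n ρ ρ<N with suc t ℕ.≟ n
  ... | yes refl rewrite ≡ᵇ-true {n} refl | ∸-≡ᵇ ρ n (ℕₚ.<⇒≤ ρ<N) n≤N | N∸n≡n+2 | ∸-≡ᵇ ρ (n ℕ.+ 2) (ℕₚ.<⇒≤ ρ<N) n+2≤N | N∸[n+2]≡n =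
    if-neg₂ (ρ ≡ᵇ n) (ρ ≡ᵇ (n ℕ.+ 2)) (+ 2) (- + 2) (≡ᵇ-disjoint ρ (ℕₚ.m<m+n n {2} (s≤s z≤n)))
  ... | no 1+t≢n = Interior.displacement-reflect t t≤n 1+t≢n ρ ρ<N

  displacement-0 : ∀ t → t ℕ.≤ n → displacement n t 0 ≡ + 0
  displacement-0 zero _ = refl
  displacement-0 (suc t) t≤n with suc t ℕ.≟ n
  ... | yes refl rewrite ≡ᵇ-true {n} refl = refl
  ... | no 1+t≢n = Interior.displacement-0 t t≤n 1+t≢n

  toℕ≤n : (k : Fin (suc n)) → toℕ k ℕ.≤ n
  toℕ≤n k = ℕₚ.≤-pred (Finₚ.toℕ<n k)

  gen-neg : ∀ k j → gen n k (- j) ≡ - gen n k j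
  gen-neg k j rewrite gen≡+displacement n k (- j) | gen≡+displacement n k j with j %ℕ N ℕ.≟ 0
  ... | yes ρ≡0 rewrite mod-neg-multiple j ρ≡0 | ρ≡0 | displacement-0 (toℕ k) (toℕ≤n k) =
    sym (ℤₚ.neg-distrib-+ j (+ 0))
  ... | no ρ≢0 rewrite proj₂ (divMod-neg j ρ≢0)
                     | displacement-reflect (toℕ k) (toℕ≤n k) (j %ℕ N) (n%ℕd<d j N) =
    sym (ℤₚ.neg-distrib-+ j _)

  gen-+N : ∀ k j → gen n k (j + + N) ≡ gen n k j + + N
  gen-+N k j rewrite gen≡+displacement n k (j + + N) | gen≡+displacement n k j
    | trans (cong (λ z → (j + z) %ℕ N) (sym (ℤₚ.*-identityˡ (+ N)))) (proj₂ (divMod-+-multiple j (+ 1))) =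
    solve 3 (λ j N d → j :+ N :+ d := j :+ d :+ N) refl j (+ N) (displacement n (toℕ k) (j %ℕ N))

  evalWord-++ : ∀ u a x → evalWord n (u ++ [ a ]) x ≡ evalWord n u (gen n a x)
  evalWord-++ []      a x = refl
  evalWord-++ (b ∷ u) a x = cong (gen n b) (evalWord-++ u a x)

  evalWord-neg : ∀ u x → evalWord n u (- x) ≡ - evalWord n u x
  evalWord-neg []      x = refl
  evalWord-neg (b ∷ u) x = trans (cong (gen n b) (evalWord-neg u x)) (gen-neg b (evalWord n u x))

  evalWord-+N : ∀ u x → evalWord n u (x + + N) ≡ evalWord n u x + + N
  evalWord-+N []      x = refl
  evalWord-+N (b ∷ u) x = trans (cong (gen n b) (evalWord-+N u x)) (gen-+N b (evalWord n u x))

  pos<N : (r : Fin n) → suc (toℕ r) ℕ.< N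
  pos<N r = ℕₚ.≤-<-trans (Finₚ.toℕ<n r) n<N

  res-pos : (r : Fin n) → res n (pos r) ≡ suc (toℕ r)
  res-pos r = proj₂ (divMod-small (suc (toℕ r)) (pos<N r))

  gen₀-first : gen n zero (pos {n} zero) ≡ - + 1
  gen₀-first rewrite gen≡+displacement n zero (pos {n} zero) | res-pos zero = refl

  gen₀-other : (r : Fin m) → gen n zero (pos {n} (suc r)) ≡ pos {n} (suc r)
  gen₀-other r rewrite gen≡+displacement n zero (pos {n} (suc r)) | res-pos (suc r)
    | ≡ᵇ-false {suc (suc (toℕ r))} {N ∸ 1} (ℕₚ.<⇒≢ (s≤s (ℕₚ.≤-trans (Finₚ.toℕ<n (suc r)) (ℕₚ.m≤m+n n _)))) =
    ℤₚ.+-identityʳ _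

  genₙ-last : gen n (fromℕ n) (pos {n} (fromℕ m)) ≡ + (n ℕ.+ 2)
  genₙ-last rewrite gen≡+displacement n (fromℕ n) (pos {n} (fromℕ m)) | res-pos (fromℕ m)
    | Finₚ.toℕ-fromℕ n | Finₚ.toℕ-fromℕ m | ≡ᵇ-true {m} refl = refl

  genₙ-other : (r : Fin n) → toℕ r ≢ m → gen n (fromℕ n) (pos r) ≡ pos r
  genₙ-other r r≢m rewrite gen≡+displacement n (fromℕ n) (pos {n} r) | res-pos r | Finₚ.toℕ-fromℕ m
    | ≡ᵇ-true {m} refl | ≡ᵇ-false {suc (toℕ r)} {n} (r≢m ∘ ℕₚ.suc-injective)
    | ≡ᵇ-false {suc (toℕ r)} {n ℕ.+ 2} (ℕₚ.<⇒≢ (ℕₚ.≤-<-trans (Finₚ.toℕ<n r) (ℕₚ.m<m+n n {2} (s≤s z≤n)))) =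
    ℤₚ.+-identityʳ _

  inner≤n : (i : Fin m) → suc (toℕ i) ℕ.≤ n
  inner≤n i = ℕₚ.<⇒≤ (s≤s (Finₚ.toℕ<n i))

  inner≢n : (i : Fin m) → suc (toℕ i) ≢ n
  inner≢n i = ℕₚ.<⇒≢ (Finₚ.toℕ<n i) ∘ ℕₚ.suc-injective

  genᵢ : (i : Fin m) (r : Fin n) → gen n (suc (inject₁ i)) (pos r) ≡ pos (swapNext m i r)
  genᵢ i r rewrite gen≡+displacement n (suc (inject₁ i)) (pos {n} r) | res-pos r | Finₚ.toℕ-inject₁ i
    | ≡ᵇ-false {suc (toℕ i)} {n} (inner≢n i) | ℕₚ.∸-+-assoc N (suc (toℕ i)) 1 with toℕ r ℕ.≟ toℕ i
  ... | yes r≡i rewrite r≡i | ≡ᵇ-true {toℕ i} refl | swapNext-left m i r r≡i = cong +_ (ℕₚ.+-comm (suc (toℕ i)) 1)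
  ... | no r≢i with toℕ r ℕ.≟ suc (toℕ i)
  ...   | yes r≡1+i rewrite ≡ᵇ-false r≢i | ≡ᵇ-true {toℕ r} {toℕ i ℕ.+ 1} (trans r≡1+i (ℕₚ.+-comm 1 (toℕ i)))
                          | swapNext-right m i r r≡1+i | Finₚ.toℕ-inject₁ i | r≡1+i = refl
  ...   | no r≢1+i rewrite ≡ᵇ-false r≢i | ≡ᵇ-false {toℕ r} {toℕ i ℕ.+ 1} (r≢1+i ∘ (λ eq → trans eq (ℕₚ.+-comm (toℕ i) 1)))
                         | ≡ᵇ-false {suc (toℕ r)} {N ∸ suc (toℕ i)}
                             (ℕₚ.<⇒≢ (ℕₚ.≤-<-trans (Finₚ.toℕ<n r) (Interior.n<N∸a (toℕ i) (inner≤n i) (inner≢n i))))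
                         | ≡ᵇ-false {suc (toℕ r)} {N ∸ (suc (toℕ i) ℕ.+ 1)}
                             (ℕₚ.<⇒≢ (ℕₚ.≤-<-trans (Finₚ.toℕ<n r) (Interior.n<N∸[a+1] (toℕ i) (inner≤n i) (inner≢n i))))
                         | swapNext-other m i r r≢i r≢1+i = ℤₚ.+-identityʳ _

  data GeneratorView : Fin (suc n) → Set where
    s₀   : GeneratorView zero
    sₙ   : GeneratorView (fromℕ n)
    s[_] : (i : Fin m) → GeneratorView (suc (inject₁ i))

  generatorView : ∀ k → GeneratorView k
  generatorView zero    = s₀
  generatorView (suc k) with Top.view k
  ... | Top.‵fromℕ     = sₙ
  ... | Top.‵inject₁ i = s[ i ]

  Window : Set
  Window = Fin n → ℤ

  last : Fin n
  last = fromℕ m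

  reflectₙ : ℤ → ℤ
  reflectₙ x = + N - x

  move : ∀ {k} → GeneratorView k → Window → Window
  move s₀      V = updateAt V zero (-_)
  move sₙ      V = updateAt V last reflectₙ
  move s[ i ]  V = V ∘ swapNext m i

  window : List (Fin (suc n)) → Window
  window u r = evalWord n u (pos r)

  pos-last : pos {n} last ≡ + n
  pos-last = cong (+_ ∘ suc) (Finₚ.toℕ-fromℕ m)

  n+2≡-n+N : + (n ℕ.+ 2) ≡ - + n + + N
  n+2≡-n+N = begin
    + (n ℕ.+ 2)                  ≡⟨ solve 2 (λ x k → x := :- k :+ (k :+ x)) refl (+ (n ℕ.+ 2)) (+ n) ⟩
    - + n + + (n ℕ.+ (n ℕ.+ 2))  ≡⟨ cong (λ z → - + n + + z) (sym N≡n+[n+2]) ⟩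
    - + n + + N                  ∎
    where open ≡-Reasoning

  window-++ : ∀ u {k} (g : GeneratorView k) r → window (u ++ [ k ]) r ≡ move g (window u) r
  window-++ u s₀ zero = begin
    evalWord n (u ++ [ zero ]) (pos {n} zero)  ≡⟨ evalWord-++ u zero (pos {n} zero) ⟩
    evalWord n u (gen n zero (pos {n} zero))   ≡⟨ cong (evalWord n u) gen₀-first ⟩
    evalWord n u (- + 1)                       ≡⟨ evalWord-neg u (+ 1) ⟩
    - window u zero                            ∎
    where open ≡-Reasoning
  window-++ u s₀ (suc r) = trans (evalWord-++ u zero (pos {n} (suc r))) (cong (evalWord n u) (gen₀-other r))
  window-++ u sₙ r with r Fin.≟ last
  ... | yes refl = begin
    evalWord n (u ++ [ fromℕ n ]) (pos last)  ≡⟨ evalWord-++ u (fromℕ n) (pos last) ⟩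
    evalWord n u (gen n (fromℕ n) (pos last)) ≡⟨ cong (evalWord n u) (trans genₙ-last n+2≡-n+N) ⟩
    evalWord n u (- + n + + N)                ≡⟨ evalWord-+N u (- + n) ⟩
    evalWord n u (- + n) + + N                ≡⟨ cong (_+ + N) (evalWord-neg u (+ n)) ⟩
    - evalWord n u (+ n) + + N                ≡⟨ ℤₚ.+-comm (- evalWord n u (+ n)) (+ N) ⟩
    + N - evalWord n u (+ n)                  ≡⟨ cong (λ z → + N - evalWord n u z) pos-last ⟨
    + N - window u last                       ≡⟨ updateAt-updates last (window u) ⟨
    updateAt (window u) last reflectₙ last    ∎
    where open ≡-Reasoning
  ... | no r≢last = begin
    evalWord n (u ++ [ fromℕ n ]) (pos r)  ≡⟨ evalWord-++ u (fromℕ n) (pos r) ⟩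
    evalWord n u (gen n (fromℕ n) (pos r)) ≡⟨ cong (evalWord n u) (genₙ-other r (r≢last ∘ toℕ≡m⇒≡last)) ⟩
    window u r                             ≡⟨ updateAt-minimal r last (window u) r≢last ⟨
    updateAt (window u) last reflectₙ r    ∎
    where
    open ≡-Reasoning
    toℕ≡m⇒≡last : toℕ r ≡ m → r ≡ last
    toℕ≡m⇒≡last eq = Finₚ.toℕ-injective (trans eq (sym (Finₚ.toℕ-fromℕ m)))
  window-++ u s[ i ] r = trans (evalWord-++ u (suc (inject₁ i)) (pos r)) (cong (evalWord n u) (genᵢ i r))

  half : ℤ
  half = + suc n

  N≡half+half : + N ≡ half + half
  N≡half+half = cong +_ N≡[1+n]+[1+n]

  -x+half≡ : ∀ x → - x + half ≡ - (x + half) + + 1 * + N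
  -x+half≡ x = trans (solve 2 (λ x h → :- x :+ h := :- (x :+ h) :+ con (+ 1) :* (h :+ h)) refl x half)
                          (cong (λ z → - (x + half) + + 1 * z) (sym N≡half+half))

  complement+half≡ : ∀ x → + N - x + half ≡ - (x + half) + + 2 * + N
  complement+half≡ x = trans (cong (λ z → z - x + half) N≡half+half)
    (trans (solve 2 (λ x h → (h :+ h) :- x :+ h := :- (x :+ h) :+ con (+ 2) :* (h :+ h)) refl x half)
           (cong (λ z → - (x + half) + + 2 * z) (sym N≡half+half)))

  walls-half-neg : ∀ x → NotMultiple (x + half) → walls (- x + half) ≡ walls (x + half)
  walls-half-neg x x+half≢0 = trans (cong walls (-x+half≡ x)) (walls-reflect (x + half) x+half≢0)

  private
    walls-half-complement : ∀ x → NotMultiple (x + half) → walls (+ N - x + half) ≡ ∣ (x + half) /ℕ N - + 1 ∣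
    walls-half-complement x x+half≢0 = begin
      walls (+ N - x + half)             ≡⟨ cong walls (complement+half≡ x) ⟩
      walls (- (x + half) + + 2 * + N)   ≡⟨ walls-+-multiple (- (x + half)) (+ 2) ⟩
      ∣ - (x + half) /ℕ N + + 2 ∣        ≡⟨ cong (λ z → ∣ z + + 2 ∣) (proj₁ (divMod-neg (x + half) x+half≢0)) ⟩
      ∣ - q - + 1 + + 2 ∣                ≡⟨ cong ∣_∣ (solve 1 (λ q → (:- q :- con (+ 1)) :+ con (+ 2) := :- (q :- con (+ 1))) refl q) ⟩
      ∣ - (q - + 1) ∣                    ≡⟨ ℤₚ.∣-i∣≡∣i∣ (q - + 1) ⟩
      ∣ q - + 1 ∣                        ∎
      where
      open ≡-Reasoning
      q = (x + half) /ℕ N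

  walls-half-complement-≤ : ∀ x → NotMultiple (x + half) → walls (+ N - x + half) ℕ.≤ suc (walls (x + half))
  walls-half-complement-≤ x x+half≢0 = subst₂ ℕ._≤_ (sym (walls-half-complement x x+half≢0))
    (cong (suc ∘ ∣_∣) (solve 1 (λ q → q :- con (+ 1) :+ con (+ 1) := q) refl ((x + half) /ℕ N)))
    (∣i∣≤1+∣i+1∣ ((x + half) /ℕ N - + 1))

  walls-half-complement-< : ∀ x → NotMultiple (x + half) → half < x → suc (walls (+ N - x + half)) ≡ walls (x + half)
  walls-half-complement-< x x+half≢0 half<x = trans (cong suc (walls-half-complement x x+half≢0)) (1≤i⇒1+∣i-1∣≡∣i∣ (/ℕ-≥1 (x + half) N≤x+half))
    where
    N≤x+half : + N ≤ x + half
    N≤x+half = subst (_≤ x + half) (sym N≡half+half) (ℤₚ.+-monoˡ-≤ half (ℤₚ.<⇒≤ half<x))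

  walls₀ : Window → ℕ
  walls₀ V = sum (walls ∘ V)

  wallsₙ : Window → ℕ
  wallsₙ V = sum (λ r → walls (V r + half))

  open PairSum pairWalls

  wallsᵢ : Window → ℕ
  wallsᵢ V = pairSum n V

  record Regular (V : Window) : Set where
    constructor regular
    field
      avoids₀ : ∀ r → NotMultiple (V r)
      avoidsₙ : ∀ r → NotMultiple (V r + half)
      avoidsᵢ : ∀ r r′ → r ≢ r′ → NotMultiple (V r - V r′) × NotMultiple (V r + V r′)

  private
    notMultiple-≡ : ∀ {x y} → y ≡ x → NotMultiple x → NotMultiple y
    notMultiple-≡ y≡x = subst NotMultiple (sym y≡x)

  regular-s₀ : ∀ {V} → Regular V → Regular (move s₀ V)
  regular-s₀ {V} (regular a₀ aₙ aᵢ) = regular b₀ bₙ bᵢ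
    where
    b₀ : ∀ r → NotMultiple (move s₀ V r)
    b₀ zero    = notMultiple-neg (V zero) (a₀ zero)
    b₀ (suc r) = a₀ (suc r)
    bₙ : ∀ r → NotMultiple (move s₀ V r + half)
    bₙ zero    = notMultiple-≡ (-x+half≡ (V zero)) (notMultiple-reflect (V zero + half) (+ 1) (aₙ zero))
    bₙ (suc r) = aₙ (suc r)
    bᵢ : ∀ r r′ → r ≢ r′ → NotMultiple (move s₀ V r - move s₀ V r′) × NotMultiple (move s₀ V r + move s₀ V r′)
    bᵢ zero    zero     r≢r′ = ⊥-elim (r≢r′ refl)
    bᵢ zero    (suc r′) r≢r′ =
      notMultiple-≡ (solve 2 (λ x y → :- x :- y := :- (x :+ y)) refl (V zero) (V (suc r′))) (notMultiple-neg (V zero + V (suc r′)) (proj₂ (aᵢ zero (suc r′) r≢r′))) ,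
      notMultiple-≡ (solve 2 (λ x y → :- x :+ y := :- (x :- y)) refl (V zero) (V (suc r′))) (notMultiple-neg (V zero - V (suc r′)) (proj₁ (aᵢ zero (suc r′) r≢r′)))
    bᵢ (suc r) zero     r≢r′ =
      notMultiple-≡ (solve 2 (λ x y → y :- (:- x) := y :+ x) refl (V zero) (V (suc r))) (proj₂ (aᵢ (suc r) zero r≢r′)) ,
      proj₁ (aᵢ (suc r) zero r≢r′)
    bᵢ (suc r) (suc r′) r≢r′ = aᵢ (suc r) (suc r′) r≢r′

  updateAt-last-view : ∀ (V : Window) f r →
    (r ≡ last × updateAt V last f r ≡ f (V last)) ⊎ (r ≢ last × updateAt V last f r ≡ V r)
  updateAt-last-view V f r with r Fin.≟ last
  ... | yes refl   = inj₁ (refl , updateAt-updates last V)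
  ... | no r≢last  = inj₂ (r≢last , updateAt-minimal r last V r≢last)

  regular-sₙ : ∀ {V} → Regular V → Regular (move sₙ V)
  regular-sₙ {V} (regular a₀ aₙ aᵢ) = regular b₀ bₙ bᵢ
    where
    x = V last
    view = updateAt-last-view V reflectₙ
    b₀ : ∀ r → NotMultiple (move sₙ V r)
    b₀ r with view r
    ... | inj₁ (refl , eq) = notMultiple-≡ (trans eq (solve 2 (λ x N → N :- x := :- x :+ con (+ 1) :* N) refl x (+ N)))
                                            (notMultiple-reflect x (+ 1) (a₀ last))
    ... | inj₂ (_ , eq)    = notMultiple-≡ eq (a₀ r)
    bₙ : ∀ r → NotMultiple (move sₙ V r + half)
    bₙ r with view r
    ... | inj₁ (refl , eq) = notMultiple-≡ (trans (cong (_+ half) eq) (complement+half≡ x)) (notMultiple-reflect (x + half) (+ 2) (aₙ last))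
    ... | inj₂ (_ , eq)    = notMultiple-≡ (cong (_+ half) eq) (aₙ r)
    bᵢ : ∀ r r′ → r ≢ r′ → NotMultiple (move sₙ V r - move sₙ V r′) × NotMultiple (move sₙ V r + move sₙ V r′)
    bᵢ r r′ r≢r′ with view r | view r′
    ... | inj₁ (refl , _) | inj₁ (refl , _) = ⊥-elim (r≢r′ refl)
    ... | inj₁ (refl , eq) | inj₂ (_ , eq′) =
      notMultiple-≡ (trans (cong₂ _-_ eq eq′) (solve 3 (λ x y N → (N :- x) :- y := :- (x :+ y) :+ con (+ 1) :* N) refl x (V r′) (+ N)))
        (notMultiple-reflect (x + V r′) (+ 1) (proj₂ (aᵢ last r′ r≢r′))) ,
      notMultiple-≡ (trans (cong₂ _+_ eq eq′) (solve 3 (λ x y N → (N :- x) :+ y := :- (x :- y) :+ con (+ 1) :* N) refl x (V r′) (+ N)))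
        (notMultiple-reflect (x - V r′) (+ 1) (proj₁ (aᵢ last r′ r≢r′)))
    ... | inj₂ (_ , eq) | inj₁ (refl , eq′) =
      notMultiple-≡ (trans (cong₂ _-_ eq eq′) (solve 3 (λ x y N → y :- (N :- x) := (y :+ x) :+ con (-[1+ 0 ]) :* N) refl x (V r) (+ N)))
        (notMultiple-+-multiple (V r + x) -[1+ 0 ] (proj₂ (aᵢ r last r≢r′))) ,
      notMultiple-≡ (trans (cong₂ _+_ eq eq′) (solve 3 (λ x y N → y :+ (N :- x) := (y :- x) :+ con (+ 1) :* N) refl x (V r) (+ N)))
        (notMultiple-+-multiple (V r - x) (+ 1) (proj₁ (aᵢ r last r≢r′)))
    ... | inj₂ (_ , eq) | inj₂ (_ , eq′) =
      notMultiple-≡ (cong₂ _-_ eq eq′) (proj₁ (aᵢ r r′ r≢r′)) , notMultiple-≡ (cong₂ _+_ eq eq′) (proj₂ (aᵢ r r′ r≢r′))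

  regular-s[] : ∀ {V} i → Regular V → Regular (move s[ i ] V)
  regular-s[] i (regular a₀ aₙ aᵢ) = regular (a₀ ∘ swapNext m i) (aₙ ∘ swapNext m i)
    (λ r r′ r≢r′ → aᵢ (swapNext m i r) (swapNext m i r′) (r≢r′ ∘ swapNext-injective m i))

  regular-move : ∀ {k V} (g : GeneratorView k) → Regular V → Regular (move g V)
  regular-move s₀     = regular-s₀
  regular-move sₙ     = regular-sₙ
  regular-move s[ i ] = regular-s[] i

  module _ {V : Window} (reg : Regular V) where
    open Regular reg

    walls₀-s₀-≤ : walls₀ (move s₀ V) ℕ.≤ suc (walls₀ V)
    walls₀-s₀-≤ = ℕₚ.+-monoˡ-≤ (sum (walls ∘ V ∘ suc)) (walls-neg-≤ (V zero) (avoids₀ zero))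

    walls₀-s₀-< : V zero < + 0 → suc (walls₀ (move s₀ V)) ≡ walls₀ V
    walls₀-s₀-< V₀<0 = cong (ℕ._+ sum (walls ∘ V ∘ suc)) (walls-neg-<0 (V zero) (avoids₀ zero) V₀<0)

    wallsₙ-s₀ : wallsₙ (move s₀ V) ≡ wallsₙ V
    wallsₙ-s₀ = cong (ℕ._+ sum (λ r → walls (V (suc r) + half))) (walls-half-neg (V zero) (avoidsₙ zero))

    wallsᵢ-s₀ : wallsᵢ (move s₀ V) ≡ wallsᵢ V
    wallsᵢ-s₀ = pairSum-cong n V (move s₀ V) same
      where
      same : ∀ r r′ → toℕ r ℕ.< toℕ r′ → pairWalls (move s₀ V r) (move s₀ V r′) ≡ pairWalls (V r) (V r′)
      same zero    (suc r′) _ = pairWalls-neg (V zero) (V (suc r′))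
        (proj₂ (avoidsᵢ zero (suc r′) (λ ()))) (proj₁ (avoidsᵢ zero (suc r′) (λ ())))
      same (suc r) (suc r′) _ = refl

    walls₀-sₙ : walls₀ (move sₙ V) ≡ walls₀ V
    walls₀-sₙ = exchange-≡ (sum-updateAt walls V last reflectₙ) (walls-complement (V last) (avoids₀ last))

    wallsₙ-sₙ-≤ : wallsₙ (move sₙ V) ℕ.≤ suc (wallsₙ V)
    wallsₙ-sₙ-≤ = exchange-≤ (sum-updateAt (λ x → walls (x + half)) V last reflectₙ)
      (walls-half-complement-≤ (V last) (avoidsₙ last))

    wallsₙ-sₙ-< : half < V last → suc (wallsₙ (move sₙ V)) ≡ wallsₙ V
    wallsₙ-sₙ-< half<V = exchange-< (sum-updateAt (λ x → walls (x + half)) V last reflectₙ)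
      (walls-half-complement-< (V last) (avoidsₙ last) half<V)

    wallsᵢ-s[]-≤ : ∀ i → wallsᵢ (move s[ i ] V) ℕ.≤ suc (wallsᵢ V)
    wallsᵢ-s[]-≤ i = exchange-≤ (pairSum-swapNext m i V)
      (pairWalls-swap-≤ (V (inject₁ i)) (V (suc i)) (proj₁ (avoidsᵢ (inject₁ i) (suc i) (inject₁≢suc i))))

    wallsᵢ-s[]-< : ∀ i → V (suc i) < V (inject₁ i) → suc (wallsᵢ (move s[ i ] V)) ≡ wallsᵢ V
    wallsᵢ-s[]-< i descent = exchange-< (pairSum-swapNext m i V)
      (pairWalls-swap-< (V (inject₁ i)) (V (suc i)) (proj₁ (avoidsᵢ (inject₁ i) (suc i) (inject₁≢suc i))) descent)

  wallsᵢ-sₙ : ∀ V → wallsᵢ (move sₙ V) ≡ wallsᵢ V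
  wallsᵢ-sₙ V = pairSum-cong n V (move sₙ V) same
    where
    r≢last : ∀ {r r′ : Fin n} → toℕ r ℕ.< toℕ r′ → r ≢ last
    r≢last {r′ = r′} r<r′ refl = ℕₚ.<⇒≱ r<r′ (subst (toℕ r′ ℕ.≤_) (sym (Finₚ.toℕ-fromℕ m)) (ℕₚ.≤-pred (Finₚ.toℕ<n r′)))
    same : ∀ r r′ → toℕ r ℕ.< toℕ r′ → pairWalls (move sₙ V r) (move sₙ V r′) ≡ pairWalls (V r) (V r′)
    same r r′ r<r′ with updateAt-last-view V reflectₙ r′
    ... | inj₁ (refl , eq) = trans (cong₂ pairWalls (updateAt-minimal r last V (r≢last r<r′)) eq) (pairWalls-complement (V r) (V last))
    ... | inj₂ (_ , eq)    = cong₂ pairWalls (updateAt-minimal r last V (r≢last r<r′)) eq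

  walls₀-s[] : ∀ i V → walls₀ (move s[ i ] V) ≡ walls₀ V
  walls₀-s[] i V = sum-swapNext m i (walls ∘ V)

  wallsₙ-s[] : ∀ i V → wallsₙ (move s[ i ] V) ≡ wallsₙ V
  wallsₙ-s[] i V = sum-swapNext m i (λ r → walls (V r + half))

  _≈_ : Window → Window → Set
  V ≈ V′ = ∀ r → V r ≡ V′ r

  walls₀-cong : ∀ {V V′} → V ≈ V′ → walls₀ V ≡ walls₀ V′
  walls₀-cong V≈V′ = sum-cong-≗ (cong walls ∘ V≈V′)

  wallsₙ-cong : ∀ {V V′} → V ≈ V′ → wallsₙ V ≡ wallsₙ V′
  wallsₙ-cong V≈V′ = sum-cong-≗ (cong (λ x → walls (x + half)) ∘ V≈V′)

  wallsᵢ-cong : ∀ {V V′} → V ≈ V′ → wallsᵢ V ≡ wallsᵢ V′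
  wallsᵢ-cong {V} {V′} V≈V′ = sym (pairSum-cong n V V′ (λ r r′ _ → sym (cong₂ pairWalls (V≈V′ r) (V≈V′ r′))))

  regular-cong : ∀ {V V′} → V ≈ V′ → Regular V → Regular V′
  regular-cong V≈V′ (regular a₀ aₙ aᵢ) = regular
    (λ r → subst NotMultiple (V≈V′ r) (a₀ r))
    (λ r → subst NotMultiple (cong (_+ half) (V≈V′ r)) (aₙ r))
    (λ r r′ r≢r′ → subst NotMultiple (cong₂ _-_ (V≈V′ r) (V≈V′ r′)) (proj₁ (aᵢ r r′ r≢r′)) ,
                   subst NotMultiple (cong₂ _+_ (V≈V′ r) (V≈V′ r′)) (proj₂ (aᵢ r r′ r≢r′)))

  move-bounds : ∀ {k V} (g : GeneratorView k) → Regular V →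
    walls₀ (move g V) ℕ.≤ walls₀ V ℕ.+ occ zero [ k ] ×
    wallsₙ (move g V) ℕ.≤ wallsₙ V ℕ.+ occ (fromℕ n) [ k ] ×
    wallsᵢ (move g V) ℕ.+ occ zero [ k ] ℕ.+ occ (fromℕ n) [ k ] ℕ.≤ suc (wallsᵢ V)
  move-bounds {V = V} s₀ reg =
    subst (walls₀ (move s₀ V) ℕ.≤_) (ℕₚ.+-comm 1 (walls₀ V)) (walls₀-s₀-≤ reg) ,
    ℕₚ.≤-reflexive (trans (wallsₙ-s₀ reg) (sym (ℕₚ.+-identityʳ (wallsₙ V)))) ,
    ℕₚ.≤-reflexive (trans (ℕₚ.+-identityʳ _) (trans (ℕₚ.+-comm (wallsᵢ (move s₀ V)) 1) (cong suc (wallsᵢ-s₀ reg))))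
  move-bounds {V = V} sₙ reg rewrite ≡ᵇ-true {toℕ (fromℕ n)} refl =
    ℕₚ.≤-reflexive (trans (walls₀-sₙ reg) (sym (ℕₚ.+-identityʳ (walls₀ V)))) ,
    subst (wallsₙ (move sₙ V) ℕ.≤_) (ℕₚ.+-comm 1 (wallsₙ V)) (wallsₙ-sₙ-≤ reg) ,
    ℕₚ.≤-reflexive (trans (cong (ℕ._+ 1) (ℕₚ.+-identityʳ _)) (trans (ℕₚ.+-comm (wallsᵢ (move sₙ V)) 1) (cong suc (wallsᵢ-sₙ V))))
  move-bounds {V = V} s[ i ] reg
    rewrite ≡ᵇ-false {toℕ (fromℕ m)} {toℕ (inject₁ i)} (Finₚ.toℕ-inject₁-≢ i ∘ trans (sym (Finₚ.toℕ-fromℕ m))) =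
    ℕₚ.≤-reflexive (trans (walls₀-s[] i V) (sym (ℕₚ.+-identityʳ (walls₀ V)))) ,
    ℕₚ.≤-reflexive (trans (wallsₙ-s[] i V) (sym (ℕₚ.+-identityʳ (wallsₙ V)))) ,
    subst (ℕ._≤ suc (wallsᵢ V)) (sym (trans (ℕₚ.+-identityʳ _) (ℕₚ.+-identityʳ _))) (wallsᵢ-s[]-≤ reg i)

  record LowerBounds (u : List (Fin (suc n))) : Set where
    constructor lowerBounds
    field
      regularity : Regular (window u)
      walls₀≤    : walls₀ (window u) ℕ.≤ occ zero u
      wallsₙ≤    : wallsₙ (window u) ℕ.≤ occ (fromℕ n) u
      wallsᵢ≤    : wallsᵢ (window u) ℕ.+ occ zero u ℕ.+ occ (fromℕ n) u ℕ.≤ wallsᵢ (window []) ℕ.+ length u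

  affineWindow : (c σ : Fin n → ℤ) → Window
  affineWindow c σ r = + N * c r + σ r

  affineWindow≡ : ∀ c σ r → affineWindow c σ r ≡ σ r + c r * + N
  affineWindow≡ c σ r = solve 3 (λ N c s → N :* c :+ s := s :+ c :* N) refl (+ N) (c r) (σ r)

  +half-range : ∀ s → ∣ s ∣ ℕ.≤ n → Σ ℕ λ k → (s + half ≡ + suc k) × (suc k ℕ.< N)
  +half-range (+ s)      s≤n = s ℕ.+ n , cong +_ (ℕₚ.+-suc s n) ,
    subst (ℕ._< N) (ℕₚ.+-suc s n) (ℕₚ.≤-<-trans (ℕₚ.+-monoˡ-≤ (suc n) s≤n) n+[1+n]<N)
  +half-range -[1+ s ]   s<n = n ∸ suc s ,
    trans (ℤₚ.⊖-≥ (ℕₚ.m≤n⇒m≤1+n s<n)) (cong +_ (ℕₚ.+-∸-assoc 1 s<n)) ,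
    ℕₚ.≤-<-trans (s≤s (ℕₚ.m∸n≤m n (suc s))) 1+n<N

  walls-+half-+multiple : ∀ s k → ∣ s ∣ ℕ.≤ n → walls (s + half + k * + N) ≡ ∣ k ∣
  walls-+half-+multiple s k s≤n with +half-range s s≤n
  ... | t , s+half≡ , t<N = trans (walls-+-multiple (s + half) k)
    (cong ∣_∣ (trans (cong (λ q → q /ℕ N + k) s+half≡)
      (trans (cong (_+ k) (proj₁ (divMod-small (suc t) t<N))) (ℤₚ.+-identityˡ k))))

  regular-affine : ∀ c σ → IsSignedPerm n σ → Regular (affineWindow c σ)
  regular-affine c σ (σ≢0 , ∣σ∣≤n , ∣σ∣-injective) = regular a₀ aₙ aᵢ
    where
    W = affineWindow c σ
    ∣σ∣<N : ∀ r → ∣ σ r ∣ ℕ.< N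
    ∣σ∣<N r = ℕₚ.≤-<-trans (∣σ∣≤n r) n<N
    a₀ : ∀ r → NotMultiple (W r)
    a₀ r = subst NotMultiple (sym (affineWindow≡ c σ r))
      (notMultiple-+-multiple (σ r) (c r) (notMultiple-small (σ r) (σ≢0 r) (∣σ∣<N r)))
    aₙ : ∀ r → NotMultiple (W r + half)
    aₙ r with +half-range (σ r) (∣σ∣≤n r)
    ... | t , σ+half≡ , t<N = subst NotMultiple (sym W+half≡)
      (notMultiple-+-multiple (σ r + half) (c r) (subst NotMultiple (sym σ+half≡) (notMultiple-small (+ suc t) (λ ()) t<N)))
      where
      W+half≡ : W r + half ≡ σ r + half + c r * + N
      W+half≡ = solve 4 (λ N c s h → N :* c :+ s :+ h := s :+ h :+ c :* N) refl (+ N) (c r) (σ r) half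
    aᵢ : ∀ r r′ → r ≢ r′ → NotMultiple (W r - W r′) × NotMultiple (W r + W r′)
    aᵢ r r′ r≢r′ =
      subst NotMultiple (sym W-W≡) (notMultiple-+-multiple (σ r - σ r′) (c r - c r′) (notMultiple-small (σ r - σ r′) σ-σ≢0 ∣σ-σ∣<N)) ,
      subst NotMultiple (sym W+W≡) (notMultiple-+-multiple (σ r + σ r′) (c r + c r′) (notMultiple-small (σ r + σ r′) σ+σ≢0 ∣σ+σ∣<N))
      where
      W-W≡ : W r - W r′ ≡ (σ r - σ r′) + (c r - c r′) * + N
      W-W≡ = solve 5 (λ N c s c′ s′ → (N :* c :+ s) :- (N :* c′ :+ s′) := (s :- s′) :+ (c :- c′) :* N) refl
        (+ N) (c r) (σ r) (c r′) (σ r′)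
      W+W≡ : W r + W r′ ≡ (σ r + σ r′) + (c r + c r′) * + N
      W+W≡ = solve 5 (λ N c s c′ s′ → (N :* c :+ s) :+ (N :* c′ :+ s′) := (s :+ s′) :+ (c :+ c′) :* N) refl
        (+ N) (c r) (σ r) (c r′) (σ r′)
      σ-σ≢0 : σ r - σ r′ ≢ + 0
      σ-σ≢0 eq = r≢r′ (∣σ∣-injective r r′ (cong ∣_∣ (ℤₚ.i-j≡0⇒i≡j (σ r) (σ r′) eq)))
      σ+σ≢0 : σ r + σ r′ ≢ + 0
      σ+σ≢0 eq = r≢r′ (∣σ∣-injective r r′ (trans (cong ∣_∣ σ≡-σ′) (ℤₚ.∣-i∣≡∣i∣ (σ r′))))
        where
        σ≡-σ′ : σ r ≡ - σ r′
        σ≡-σ′ = trans (solve 2 (λ x y → x := (x :+ y) :- y) refl (σ r) (σ r′))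
                      (trans (cong (_- σ r′) eq) (ℤₚ.+-identityˡ (- σ r′)))
      ∣σ∣+∣σ∣<N : ∣ σ r ∣ ℕ.+ ∣ σ r′ ∣ ℕ.< N
      ∣σ∣+∣σ∣<N = ℕₚ.≤-<-trans (ℕₚ.+-mono-≤ (∣σ∣≤n r) (∣σ∣≤n r′)) n+n<N
      ∣σ-σ∣<N = ℕₚ.≤-<-trans (ℤₚ.∣i-j∣≤∣i∣+∣j∣ (σ r) (σ r′)) ∣σ∣+∣σ∣<N
      ∣σ+σ∣<N = ℕₚ.≤-<-trans (ℤₚ.∣i+j∣≤∣i∣+∣j∣ (σ r) (σ r′)) ∣σ∣+∣σ∣<N

  identity-isSignedPerm : IsSignedPerm n pos
  identity-isSignedPerm = (λ _ ()) , Finₚ.toℕ<n , λ r r′ eq → Finₚ.toℕ-injective (ℕₚ.suc-injective eq)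

  regular-identity : Regular (window [])
  regular-identity = regular-cong (λ r → trans (affineWindow≡ (λ _ → + 0) pos r) (ℤₚ.+-identityʳ (pos r)))
    (regular-affine (λ _ → + 0) pos identity-isSignedPerm)

  walls₀-identity : walls₀ (window []) ≡ 0
  walls₀-identity = sum-≡0 _ (λ r → cong ∣_∣ (proj₁ (divMod-small (suc (toℕ r)) (pos<N r))))

  wallsₙ-identity : wallsₙ (window []) ≡ 0
  wallsₙ-identity = sum-≡0 _ (λ r → trans (cong walls (sym (ℤₚ.+-identityʳ (pos r + half))))
    (walls-+half-+multiple (pos r) (+ 0) (Finₚ.toℕ<n r)))

  lowerBounds-[] : LowerBounds []
  lowerBounds-[] = lowerBounds regular-identity (ℕₚ.≤-reflexive walls₀-identity) (ℕₚ.≤-reflexive wallsₙ-identity)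
    (ℕₚ.≤-reflexive (trans (ℕₚ.+-identityʳ _) (trans (ℕₚ.+-identityʳ _) (sym (ℕₚ.+-identityʳ _)))))

  lowerBounds-∷ʳ : ∀ u k → LowerBounds u → LowerBounds (u ++ [ k ])
  lowerBounds-∷ʳ u k (lowerBounds reg b₀ bₙ bᵢ) = lowerBounds
    (regular-cong move≈ (regular-move g reg))
    (subst₂ ℕ._≤_ (walls₀-cong move≈) (sym (occ-++ zero u k)) (add-bound {a = walls₀ (window u)} b₀ m₀))
    (subst₂ ℕ._≤_ (wallsₙ-cong move≈) (sym (occ-++ (fromℕ n) u k)) (add-bound {a = wallsₙ (window u)} bₙ mₙ))
    (subst₂ ℕ._≤_ (cong₂ ℕ._+_ (cong₂ ℕ._+_ (wallsᵢ-cong move≈) (sym (occ-++ zero u k))) (sym (occ-++ (fromℕ n) u k)))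
                  (cong (wallsᵢ (window []) ℕ.+_) (sym (Listₚ.length-++ u)))
                  (add-length-bound {c = wallsᵢ (window u)} {c′ = wallsᵢ (move g (window u))} {c₀ = wallsᵢ (window [])} bᵢ mᵢ))
    where
    g = generatorView k
    move≈ : move g (window u) ≈ window (u ++ [ k ])
    move≈ r = sym (window-++ u g r)
    bounds = move-bounds g reg
    m₀ = proj₁ bounds
    mₙ = proj₁ (proj₂ bounds)
    mᵢ = proj₂ (proj₂ bounds)

  lowerBounds-all : ∀ u → LowerBounds u
  lowerBounds-all u = go u (reverseView u)
    where
    go : ∀ u → Reverse u → LowerBounds u
    go .[]            []            = lowerBounds-[]
    go .(u ++ [ k ])  (u ∶ ru ∶ʳ k) = lowerBounds-∷ʳ u k (go u ru)

  move-cong : ∀ {k} (g : GeneratorView k) {V V′} → V ≈ V′ → move g V ≈ move g V′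
  move-cong s₀     V≈V′ zero    = cong -_ (V≈V′ zero)
  move-cong s₀     V≈V′ (suc r) = V≈V′ (suc r)
  move-cong sₙ     V≈V′ r with r Fin.≟ last
  ... | yes refl   = trans (updateAt-updates last _) (trans (cong reflectₙ (V≈V′ last)) (sym (updateAt-updates last _)))
  ... | no r≢last  = trans (updateAt-minimal r last _ r≢last) (trans (V≈V′ r) (sym (updateAt-minimal r last _ r≢last)))
  move-cong s[ i ] V≈V′ r = V≈V′ (swapNext m i r)

  move-involutive : ∀ {k} (g : GeneratorView k) V → move g (move g V) ≈ V
  move-involutive s₀     V zero    = ℤₚ.neg-involutive (V zero)
  move-involutive s₀     V (suc r) = refl
  move-involutive sₙ     V r with r Fin.≟ last
  ... | yes refl  = trans (updateAt-updates last _) (trans (cong reflectₙ (updateAt-updates last V))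
                      (solve 2 (λ N x → N :- (N :- x) := x) refl (+ N) (V last)))
  ... | no r≢last = trans (updateAt-minimal r last _ r≢last) (updateAt-minimal r last V r≢last)
  move-involutive s[ i ] V r = cong V (swapNext-involutive m i r)

  ℓ : Window → ℕ
  ℓ V = walls₀ V ℕ.+ wallsₙ V ℕ.+ wallsᵢ V

  ℓ-cong : ∀ {V V′} → V ≈ V′ → ℓ V ≡ ℓ V′
  ℓ-cong V≈V′ = cong₂ ℕ._+_ (cong₂ ℕ._+_ (walls₀-cong V≈V′) (wallsₙ-cong V≈V′)) (wallsᵢ-cong V≈V′)

  dominant-identity : ∀ {V} → Regular V → ¬ (V zero < + 0) → ¬ (half < V last) →
                      ¬ (∃ λ (i : Fin m) → V (suc i) < V (inject₁ i)) → V ≈ window []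
  dominant-identity {V} (regular a₀ aₙ aᵢ) V₀≮0 half≮V no-descent = increasing-tight m V (+ 1) 1≤V₀ increasing V-last≤
    where
    notMultiple-0 : ¬ NotMultiple (+ 0)
    notMultiple-0 x≢0 = x≢0 refl
    1≤V₀ : + 1 ≤ V zero
    1≤V₀ = ℤₚ.i<j⇒suc[i]≤j (ℤₚ.≤∧≢⇒< (ℤₚ.≮⇒≥ V₀≮0) (λ 0≡V₀ → notMultiple-0 (subst NotMultiple (sym 0≡V₀) (a₀ zero))))
    increasing : ∀ i → V (inject₁ i) < V (suc i)
    increasing i = ℤₚ.≤∧≢⇒< (ℤₚ.≮⇒≥ (λ lt → no-descent (i , lt)))
      (λ eq → notMultiple-0 (subst NotMultiple (trans (cong (_- V (suc i)) eq) (ℤₚ.+-inverseʳ (V (suc i))))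
                                                (proj₁ (aᵢ (inject₁ i) (suc i) (inject₁≢suc i)))))
    V-last≤ : V last ≤ + 1 + + m
    V-last≤ = i<1+j⇒i≤j (ℤₚ.≤∧≢⇒< (ℤₚ.≮⇒≥ half≮V)
      (λ eq → notMultiple-N (subst NotMultiple (trans (cong (_+ half) eq) (sym N≡half+half)) (aₙ last))))

  data Descent (V : Window) : Set where
    descent  : ∀ {k} (g : GeneratorView k) → suc (ℓ (move g V)) ≡ ℓ V → Descent V
    identity : V ≈ window [] → Descent V

  descent? : ∀ V → Regular V → Descent V
  descent? V reg with V zero <? + 0
  ... | yes V₀<0 = descent s₀ (cong₂ ℕ._+_ (cong₂ ℕ._+_ (walls₀-s₀-< reg V₀<0) (wallsₙ-s₀ reg)) (wallsᵢ-s₀ reg))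
  ... | no V₀≮0 with half <? V last
  ...   | yes half<V = descent sₙ (trans (cong (ℕ._+ wallsᵢ (move sₙ V)) (sym (ℕₚ.+-suc (walls₀ (move sₙ V)) _)))
          (cong₂ ℕ._+_ (cong₂ ℕ._+_ (walls₀-sₙ reg) (wallsₙ-sₙ-< reg half<V)) (wallsᵢ-sₙ V)))
  ...   | no half≮V with Finₚ.any? (λ (i : Fin m) → V (suc i) <? V (inject₁ i))
  ...     | yes (i , desc) = descent s[ i ] (trans (sym (ℕₚ.+-suc (walls₀ (move s[ i ] V) ℕ.+ wallsₙ (move s[ i ] V)) _))
            (cong₂ ℕ._+_ (cong₂ ℕ._+_ (walls₀-s[] i V) (wallsₙ-s[] i V)) (wallsᵢ-s[]-< reg i desc)))
  ...     | no no-descent = identity (dominant-identity reg V₀≮0 half≮V no-descent)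

  ShortWord : Window → Set
  ShortWord V = Σ (List (Fin (suc n))) λ v → Represents n V v × length v ℕ.+ ℓ (window []) ℕ.≤ ℓ V

  shortWord-∷ʳ : ∀ {k} (g : GeneratorView k) V → suc (ℓ (move g V)) ≡ ℓ V → ShortWord (move g V) → ShortWord V
  shortWord-∷ʳ {k} g V ℓ-desc (v , v-rep , v-short) = v ++ [ k ] , rep , short
    where
    rep : Represents n V (v ++ [ k ])
    rep r = trans (window-++ v g r) (trans (move-cong g v-rep r) (move-involutive g V r))
    short : length (v ++ [ k ]) ℕ.+ ℓ (window []) ℕ.≤ ℓ V
    short = begin
      length (v ++ [ k ]) ℕ.+ ℓ (window [])  ≡⟨ cong (ℕ._+ ℓ (window [])) (trans (Listₚ.length-++ v) (ℕₚ.+-comm (length v) 1)) ⟩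
      suc (length v ℕ.+ ℓ (window []))       ≤⟨ s≤s v-short ⟩
      suc (ℓ (move g V))                     ≡⟨ ℓ-desc ⟩
      ℓ V                                    ∎
      where open ℕₚ.≤-Reasoning

  shortWord : ∀ fuel V → Regular V → ℓ V ℕ.≤ fuel → ShortWord V
  shortWord fuel V reg ℓ≤fuel with descent? V reg
  ... | identity V≈id = [] , (sym ∘ V≈id) , ℕₚ.≤-reflexive (ℓ-cong (sym ∘ V≈id))
  shortWord zero     V reg ℓ≤fuel | descent g ℓ-desc = ⊥-elim (ℕₚ.n≮0 (ℕₚ.≤-trans (ℕₚ.≤-reflexive ℓ-desc) ℓ≤fuel))
  shortWord (suc fuel) V reg ℓ≤fuel | descent g ℓ-desc = shortWord-∷ʳ g V ℓ-desc
    (shortWord fuel (move g V) (regular-move g reg) (ℕₚ.≤-pred (subst (ℕ._≤ suc fuel) (sym ℓ-desc) ℓ≤fuel)))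

  occ-reduced : ∀ {V} u → IsReducedWord n V u → (walls₀ V ≡ occ zero u) × (wallsₙ V ≡ occ (fromℕ n) u)
  occ-reduced {V} u (u-rep , u-minimal) = tight-bounds
    (subst (ℕ._≤ occ zero u) (walls₀-cong u-rep) walls₀≤)
    (subst (ℕ._≤ occ (fromℕ n) u) (wallsₙ-cong u-rep) wallsₙ≤)
    (subst (λ z → z ℕ.+ occ zero u ℕ.+ occ (fromℕ n) u ℕ.≤ wallsᵢ (window []) ℕ.+ length u) (wallsᵢ-cong u-rep) wallsᵢ≤)
    (u-minimal v v-rep)
    (subst (λ z → length v ℕ.+ z ℕ.≤ ℓ V) (cong₂ (λ a b → a ℕ.+ b ℕ.+ wallsᵢ (window [])) walls₀-identity wallsₙ-identity) v-short)
    where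
    open LowerBounds (lowerBounds-all u)
    short = shortWord (ℓ V) V (regular-cong u-rep regularity) ℕₚ.≤-refl
    v = proj₁ short
    v-rep = proj₁ (proj₂ short)
    v-short = proj₂ (proj₂ short)

  module _ (c σ : Fin n → ℤ) (σ-perm : IsSignedPerm n σ) (W>0 : ∀ i → + 0 < affineWindow c σ i) where
    private
      W = affineWindow c σ
      ∣σ∣≤n = proj₁ (proj₂ σ-perm)

    ∣c∣≡walls+[σ<0] : ∀ i → ∣ c i ∣ ≡ walls (W i) ℕ.+ (if does (σ i <? + 0) then 1 else 0)
    ∣c∣≡walls+[σ<0] i with σ i <? + 0
    ... | no σ≮0 = sym (trans (ℕₚ.+-identityʳ _) (cong ∣_∣ (proj₁ (divMod-unique (W i) (c i) ∣ σ i ∣ ∣σ∣<N W≡))))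
      where
      ∣σ∣<N = ℕₚ.≤-<-trans (∣σ∣≤n i) n<N
      W≡ : W i ≡ + ∣ σ i ∣ + c i * + N
      W≡ = trans (affineWindow≡ c σ i) (cong (_+ c i * + N) (sym (ℤₚ.0≤i⇒+∣i∣≡i (ℤₚ.≮⇒≥ σ≮0))))
    ... | yes σ<0 = trans (sym (1≤i⇒1+∣i-1∣≡∣i∣ 1≤c)) (trans (ℕₚ.+-comm 1 _) (cong (λ q → ∣ q ∣ ℕ.+ 1) (sym q≡)))
      where
      s = ∣ σ i ∣
      s≤N = ℕₚ.<⇒≤ (ℕₚ.≤-<-trans (∣σ∣≤n i) n<N)
      N∸s<N : N ∸ s ℕ.< N
      N∸s<N = ℕₚ.∸-monoʳ-< {o = 0} (ℕₚ.n≢0⇒n>0 (proj₁ σ-perm i ∘ ℤₚ.∣i∣≡0⇒i≡0)) s≤N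
      W≡ : W i ≡ + (N ∸ s) + (c i - + 1) * + N
      W≡ = trans (cong (λ z → + N * c i + z) (i<0⇒i≡-∣i∣ σ<0))
        (trans (solve 3 (λ N c s → N :* c :+ (:- s) := (N :- s) :+ (c :- con (+ 1)) :* N) refl (+ N) (c i) (+ s))
               (cong (_+ (c i - + 1) * + N) (sym (+[m∸n]≡+m-+n s≤N))))
      q≡ : W i /ℕ N ≡ c i - + 1
      q≡ = proj₁ (divMod-unique (W i) (c i - + 1) (N ∸ s) N∸s<N W≡)
      1≤c : + 1 ≤ c i
      1≤c = subst (+ 1 ≤_) (solve 1 (λ c → c :- con (+ 1) :+ con (+ 1) := c) refl (c i))
        (ℤₚ.+-monoˡ-≤ (+ 1) (subst (+ 0 ≤_) q≡ (0≤n⇒0≤n/ℕd (W i) N (ℤₚ.<⇒≤ (W>0 i)))))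

    walls-+half-affine : ∀ i → walls (W i + half) ≡ walls (W i) ℕ.+ (if does (σ i <? + 0) then 1 else 0)
    walls-+half-affine i = trans (cong walls W+half≡) (trans (walls-+half-+multiple (σ i) (c i) (∣σ∣≤n i)) (∣c∣≡walls+[σ<0] i))
      where
      W+half≡ : W i + half ≡ σ i + half + c i * + N
      W+half≡ = solve 4 (λ N c s h → N :* c :+ s :+ h := s :+ h :+ c :* N) refl (+ N) (c i) (σ i) half

    wallsₙ≡walls₀+neg : wallsₙ W ≡ walls₀ W ℕ.+ neg n σ
    wallsₙ≡walls₀+neg = trans (sum-cong-≗ walls-+half-affine) (sum-+-countFin (walls ∘ W) (λ i → does (σ i <? + 0)))

    neg+occ₀≡occₙ : ∀ u → IsReducedWord n W u → neg n σ ℕ.+ occ zero u ≡ occ (fromℕ n) u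
    neg+occ₀≡occₙ u reduced = begin
      neg n σ ℕ.+ occ zero u  ≡⟨ cong (neg n σ ℕ.+_) (proj₁ (occ-reduced u reduced)) ⟨
      neg n σ ℕ.+ walls₀ W    ≡⟨ ℕₚ.+-comm (neg n σ) (walls₀ W) ⟩
      walls₀ W ℕ.+ neg n σ    ≡⟨ wallsₙ≡walls₀+neg ⟨
      wallsₙ W                ≡⟨ proj₂ (occ-reduced u reduced) ⟩
      occ (fromℕ n) u         ∎
      where open ≡-Reasoning

open CeilingParity using (oddCeil≡neg)

neg+occ₀≡occₙ : ∀ n (c σ : Fin n → ℤ) → IsSignedPerm n σ → (∀ i → + 0 ℤ.< + NN n ℤ.* c i ℤ.+ σ i) →
                ∀ u → IsReducedWord n (λ i → + NN n ℤ.* c i ℤ.+ σ i) u → neg n σ ℕ.+ occ zero u ≡ occ (fromℕ n) u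
neg+occ₀≡occₙ zero    c σ _      _   []      _              = refl
neg+occ₀≡occₙ zero    c σ _      _   (_ ∷ _) (_ , minimal)  = ⊥-elim (ℕₚ.n≮0 (minimal [] (λ ())))
neg+occ₀≡occₙ (suc m) c σ σ-perm W>0 u       reduced        = Affine.neg+occ₀≡occₙ m c σ σ-perm W>0 u reduced

open import Data.Nat using (_+_)
open import Data.Integer using (_<_)
import Data.Fin

mainTheorem17 : (n : ℕ) (c σ : Fin n → ℤ) → IsSignedPerm n σ →
    (∀ (i j : Fin n) → toℕ i Data.Nat.< toℕ j →
       (+ NN n) Data.Integer.* c i Data.Integer.+ σ i < (+ NN n) Data.Integer.* c j Data.Integer.+ σ j) →
    (∀ (i : Fin n) → + 0 < (+ NN n) Data.Integer.* c i Data.Integer.+ σ i) →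
    (u : List (Fin (suc n))) →
    IsReducedWord n (λ i → (+ NN n) Data.Integer.* c i Data.Integer.+ σ i) u →
    (oddCeil n (lam n c σ) ≡ neg n σ) ×
    (neg n σ + occ Data.Fin.zero u ≡ occ (Data.Fin.fromℕ n) u)
mainTheorem17 n c σ σ-perm _ W>0 u reduced = oddCeil≡neg n c σ , neg+occ₀≡occₙ n c σ σ-perm W>0 u reduced
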